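{- Let $l\geq 3$ and let $m\geq 2^{l-1}+1$ be odd. Then the Cayley graph $\mathrm{Cay}(\mathbb{Z}_m\times\mathbb{Z}_{2^l},\ \{\pm1\}\times\{\pm1,\ 2^{l-1}\})$ can be decomposed into two $C_{2^l}$-factors and one $C_m$-factor.
   Context: For a finite additive group $\Gamma$ and a subset $S\subseteq\Gamma\setminus\{0\}$ closed under negatives, the Cayley graph $\mathrm{Cay}(\Gamma,S)$ has vertex set $\Gamma$ and an edge between $a$ and $b$ whenever $a-b\in S$. Here $\{\pm1\}\times T$ denotes the set of pairs $(\epsilon,t)$ with $\epsilon\in\{1,-1\}\subseteq\mathbb{Z}_m$ and $t\in T$. A $C_k$-factor of a graph is a spanning subgraph each of whose components is a cycle of length $k$; decomposing a graph into factors means partitioning its edge set into the edge sets of these factors. -}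

module Defs where

open import Data.Nat using (ℕ; zero; suc; _+_; _∸_; _^_; _%_)
open import Data.Fin using (Fin; toℕ)
open import Data.Vec using (Vec; lookup; _∷_; [])
open import Data.Product using (Σ; ∃; _×_; _,_)
open import Data.Sum using (_⊎_)
open import Relation.Binary.PropositionalEquality using (_≡_)

_⊖_ : ∀ {m} → Fin m → Fin m → ℕ
_⊖_ {suc m} a b = (toℕ a + (suc m ∸ toℕ b)) % suc m

V : ℕ → ℕ → Set
V m n = Fin m × Fin n

Cay : (m n : ℕ) → (ℕ → ℕ → Set) → V m n → V m n → Set
Cay m n S (a₁ , a₂) (b₁ , b₂) = S (a₁ ⊖ b₁) (a₂ ⊖ b₂)

Sₗ : (l m : ℕ) → ℕ → ℕ → Set
Sₗ l m x y = (x ≡ 1 ⊎ x ≡ m ∸ 1)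
           × (y ≡ 1 ⊎ y ≡ 2 ^ l ∸ 1 ⊎ y ≡ 2 ^ (l ∸ 1))

CycNext : (k : ℕ) → Fin k → Fin k → Set
CycNext k i j = (toℕ j ≡ suc (toℕ i)) ⊎ (suc (toℕ i) ≡ k × toℕ j ≡ 0)

-- A (spanning) subgraph H of a graph on vertex set W is a C_k-factor:
-- every vertex v lies on a k-cycle f(0) f(1) ... f(k-1) f(0) of distinct
-- vertices whose edges are in H, and every H-edge leaving a cycle vertex
-- f(i) goes to a cyclic neighbour f(i±1); i.e. the component of v in H is
-- exactly this cycle of length k.
IsCkFactor : {W : Set} → ℕ → (W → W → Set) → Set
IsCkFactor {W} k H =
  ∀ (v : W) → Σ (Fin k → W) λ f →
      (∀ i j → f i ≡ f j → i ≡ j)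
    × (∃ λ i → f i ≡ v)
    × (∀ i j → CycNext k i j → H (f i) (f j))
    × (∀ i w → H (f i) w → ∃ λ j → (CycNext k i j ⊎ CycNext k j i) × w ≡ f j)

DecomposesInto : {W : Set} → (G : W → W → Set) → {r : ℕ} → Vec ℕ r → Set
DecomposesInto {W} G {r} ks =
  Σ (W → W → Fin r) λ c →
      (∀ a b → G a b → c a b ≡ c b a)
    × (∀ (i : Fin r) → IsCkFactor (lookup ks i) (λ a b → G a b × c a b ≡ i))

{-# OPTIONS --safe #-}
-- Write 2^l = N = 2h and m = M = h + 1 + 2r.  Every edge joins some (x, y) to
-- (x + 1, y + δ) with δ ∈ {1, −1, h}; colour it by the type of its left column x
-- (x = 0 or x > h; x = 1; 1 < x < h; x = h), the parity of y and the slope δ.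
-- Colour 2 takes slope h outside columns 1..h and slope −1 inside: a walk using
-- these edges advances one column per step and returns after M steps, because its
-- vertical displacement h − h + 2r·h = rN vanishes modulo N.  Outside columns 1..h
-- colours 0 and 1 form zigzags of slopes 1, −1 between two adjacent columns.  Inside,
-- a colour-0 cycle climbs from column 1 to column h + 1 along slope-1 edges and
-- comes back along slope-1 edges, the two halves joined by slope-h edges in columns
-- 1 and h; a colour-1 cycle climbs and descends along slope-h edges, joined by
-- slope-1 edges.  All these cycles have length N.  A finite check of the colour
-- table shows that every vertex meets at most two edges of each colour, so
-- exhibiting one such cycle through each vertex makes each colour class a factor.

module Submission where

open import Defs
open import Data.Bool using (Bool; true; false; not; _xor_; if_then_else_)
open import Data.Bool.Properties using (xor-same; xor-identityʳ; not-distribˡ-xor)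
open import Data.Empty using (⊥-elim)
open import Data.Fin using (Fin; toℕ; fromℕ<) renaming (zero to fz; suc to fs)
open import Data.Fin.Properties using (toℕ-injective; toℕ-fromℕ<; toℕ<n; all?) renaming (_≟_ to _≟ᶠ_)
open import Data.Nat using (ℕ; zero; suc; _+_; _*_; _∸_; _^_; _%_; _/_; _≤_; _<_; _≥_; z≤n; s≤s; NonZero; _≟_; _<?_; _≤?_)
open import Data.Nat.DivMod
open import Data.Nat.Divisibility using (_∣_; _∣0; ∣-refl; ∣m∣n⇒∣m+n)
open import Data.Nat.Properties
open import Data.Nat.Solver using (module +-*-Solver)
open import Data.Product using (Σ; ∃; _×_; _,_; proj₁; proj₂)
open import Data.Product.Properties using (≡-dec)
open import Data.Sum using (_⊎_; inj₁; inj₂) renaming (map to ⊎-map)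
open import Data.Vec using (lookup; _∷_; [])
open import Function using (_∘_)
open import Relation.Binary using (Tri; tri<; tri≈; tri>)
open import Relation.Binary.Definitions using (DecidableEquality)
open import Relation.Binary.PropositionalEquality hiding ([_])
open import Relation.Nullary using (¬_; Dec; yes; no; contradiction)
open import Relation.Nullary.Decidable using (map′; _×-dec_; _⊎-dec_; _→-dec_; ¬?; toWitness; True)

open +-*-Solver

module Residues (K-1 : ℕ) where
  K : ℕ
  K = suc K-1

  [_] : ℕ → Fin K
  [ X ] = X mod K

  _⊕_ : Fin K → ℕ → Fin K
  a ⊕ d = [ toℕ a + d ]

  toℕ-[] : ∀ X → toℕ [ X ] ≡ X % K
  toℕ-[] X = toℕ-fromℕ< (m%n<n X K)

  toℕ-[]-< : ∀ X → X < K → toℕ [ X ] ≡ X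
  toℕ-[]-< X X<K = trans (toℕ-[] X) (m<n⇒m%n≡m X<K)

  toℕ%K : ∀ (a : Fin K) → toℕ a % K ≡ toℕ a
  toℕ%K a = m<n⇒m%n≡m (toℕ<n a)

  []-toℕ : ∀ (a : Fin K) → [ toℕ a ] ≡ a
  []-toℕ a = toℕ-injective (toℕ-[]-< (toℕ a) (toℕ<n a))

  [+K] : ∀ X → [ X + K ] ≡ [ X ]
  [+K] X = toℕ-injective (trans (toℕ-[] (X + K)) (trans ([m+n]%n≡m%n X K) (sym (toℕ-[] X))))

  [+k*K] : ∀ X k → [ X + k * K ] ≡ [ X ]
  [+k*K] X k = toℕ-injective (trans (toℕ-[] (X + k * K)) (trans ([m+kn]%n≡m%n X k K) (sym (toℕ-[] X))))

  [x%K+y]%K≡[x+y]%K : ∀ x y → (x % K + y) % K ≡ (x + y) % K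
  [x%K+y]%K≡[x+y]%K x y = begin
      (x % K + y) % K          ≡⟨ %-distribˡ-+ (x % K) y K ⟩
      (x % K % K + y % K) % K  ≡⟨ cong (λ z → (z + y % K) % K) (m%n%n≡m%n x K) ⟩
      (x % K + y % K) % K      ≡⟨ %-distribˡ-+ x y K ⟨
      (x + y) % K              ∎
    where open ≡-Reasoning

  [x+y%K]%K≡[x+y]%K : ∀ x y → (x + y % K) % K ≡ (x + y) % K
  [x+y%K]%K≡[x+y]%K x y = begin
      (x + y % K) % K  ≡⟨ cong (_% K) (+-comm x (y % K)) ⟩
      (y % K + x) % K  ≡⟨ [x%K+y]%K≡[x+y]%K y x ⟩
      (y + x) % K      ≡⟨ cong (_% K) (+-comm y x) ⟩
      (x + y) % K      ∎
    where open ≡-Reasoning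

  []-⊕ : ∀ X d → [ X ] ⊕ d ≡ [ X + d ]
  []-⊕ X d = toℕ-injective (begin
      toℕ ([ X ] ⊕ d)      ≡⟨ toℕ-[] (toℕ [ X ] + d) ⟩
      (toℕ [ X ] + d) % K  ≡⟨ cong (λ z → (z + d) % K) (toℕ-[] X) ⟩
      (X % K + d) % K      ≡⟨ [x%K+y]%K≡[x+y]%K X d ⟩
      (X + d) % K          ≡⟨ toℕ-[] (X + d) ⟨
      toℕ [ X + d ]        ∎)
    where open ≡-Reasoning

  ⊕-assoc : ∀ a d e → (a ⊕ d) ⊕ e ≡ a ⊕ (d + e)
  ⊕-assoc a d e = trans ([]-⊕ (toℕ a + d) e) (cong [_] (+-assoc (toℕ a) d e))

  ⊕-K : ∀ a → a ⊕ K ≡ a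
  ⊕-K a = trans ([+K] (toℕ a)) ([]-toℕ a)

  [a⊕d]⊖a≡d%K : ∀ a d → (a ⊕ d) ⊖ a ≡ d % K
  [a⊕d]⊖a≡d%K a d = begin
      (toℕ (a ⊕ d) + (K ∸ toℕ a)) % K      ≡⟨ cong (λ z → (z + (K ∸ toℕ a)) % K) (toℕ-[] (toℕ a + d)) ⟩
      ((toℕ a + d) % K + (K ∸ toℕ a)) % K  ≡⟨ [x%K+y]%K≡[x+y]%K (toℕ a + d) _ ⟩
      (toℕ a + d + (K ∸ toℕ a)) % K        ≡⟨ cong (_% K) shift ⟩
      (d + K) % K                          ≡⟨ [m+n]%n≡m%n d K ⟩
      d % K                                ∎
    where
      open ≡-Reasoning
      shift : toℕ a + d + (K ∸ toℕ a) ≡ d + K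
      shift = begin
        toℕ a + d + (K ∸ toℕ a)    ≡⟨ cong (_+ (K ∸ toℕ a)) (+-comm (toℕ a) d) ⟩
        d + toℕ a + (K ∸ toℕ a)    ≡⟨ +-assoc d (toℕ a) _ ⟩
        d + (toℕ a + (K ∸ toℕ a))  ≡⟨ cong (d +_) (m+[n∸m]≡n (<⇒≤ (toℕ<n a))) ⟩
        d + K                      ∎

  b⊕[a⊖b]≡a : ∀ a b → b ⊕ (a ⊖ b) ≡ a
  b⊕[a⊖b]≡a a b = toℕ-injective (begin
      toℕ (b ⊕ (a ⊖ b))                        ≡⟨ toℕ-[] (toℕ b + (a ⊖ b)) ⟩
      (toℕ b + (toℕ a + (K ∸ toℕ b)) % K) % K  ≡⟨ [x+y%K]%K≡[x+y]%K (toℕ b) _ ⟩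
      (toℕ b + (toℕ a + (K ∸ toℕ b))) % K      ≡⟨ cong (_% K) shift ⟩
      (toℕ a + K) % K                          ≡⟨ [m+n]%n≡m%n (toℕ a) K ⟩
      toℕ a % K                                ≡⟨ toℕ%K a ⟩
      toℕ a                                    ∎)
    where
      open ≡-Reasoning
      shift : toℕ b + (toℕ a + (K ∸ toℕ b)) ≡ toℕ a + K
      shift = begin
        toℕ b + (toℕ a + (K ∸ toℕ b))  ≡⟨ +-assoc (toℕ b) (toℕ a) _ ⟨
        toℕ b + toℕ a + (K ∸ toℕ b)    ≡⟨ cong (_+ (K ∸ toℕ b)) (+-comm (toℕ b) (toℕ a)) ⟩
        toℕ a + toℕ b + (K ∸ toℕ b)    ≡⟨ +-assoc (toℕ a) (toℕ b) _ ⟩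
        toℕ a + (toℕ b + (K ∸ toℕ b))  ≡⟨ cong (toℕ a +_) (m+[n∸m]≡n (<⇒≤ (toℕ<n b))) ⟩
        toℕ a + K                      ∎

  ≡⊕⇒⊖≡ : ∀ a b d → a ≡ b ⊕ d → a ⊖ b ≡ d % K
  ≡⊕⇒⊖≡ a b d refl = [a⊕d]⊖a≡d%K b d

  ⊕-inverse : ∀ a b d e → a ≡ b ⊕ d → d + e ≡ K → b ≡ a ⊕ e
  ⊕-inverse a b d e refl d+e≡K = sym (trans (⊕-assoc b d e) (trans (cong (b ⊕_) d+e≡K) (⊕-K b)))

  []-cancelˡ : ∀ y a b → a < K → b < K → [ y + a ] ≡ [ y + b ] → a ≡ b
  []-cancelˡ y a b a<K b<K eq = begin
      a                    ≡⟨ m<n⇒m%n≡m a<K ⟨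
      a % K                ≡⟨ [a⊕d]⊖a≡d%K [ y ] a ⟨
      ([ y ] ⊕ a) ⊖ [ y ]  ≡⟨ cong (_⊖ [ y ]) (trans ([]-⊕ y a) (trans eq (sym ([]-⊕ y b)))) ⟩
      ([ y ] ⊕ b) ⊖ [ y ]  ≡⟨ [a⊕d]⊖a≡d%K [ y ] b ⟩
      b % K                ≡⟨ m<n⇒m%n≡m b<K ⟩
      b                    ∎
    where open ≡-Reasoning

par : ℕ → Bool
par zero = false
par (suc n) = not (par n)

par-+ : ∀ a b → par (a + b) ≡ par a xor par b
par-+ zero b = refl
par-+ (suc a) b = trans (cong not (par-+ a b)) (not-distribˡ-xor (par a) (par b))

par-double : ∀ b → par (b + b) ≡ false
par-double b = trans (par-+ b b) (xor-same (par b))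

xor≡false⇒≡ : ∀ a b → a xor b ≡ false → a ≡ b
xor≡false⇒≡ false false _ = refl
xor≡false⇒≡ true true _ = refl
xor≡false⇒≡ false true ()
xor≡false⇒≡ true false ()

par-∸-even : ∀ k m → k ≤ m → par m ≡ false → par (m ∸ k) ≡ par k
par-∸-even k m le pm = xor≡false⇒≡ _ _ (trans (sym (par-+ (m ∸ k) k)) (trans (cong par (m∸n+n≡m le)) pm))

xor-cancelˡ : ∀ a b b′ → a xor b ≡ a xor b′ → b ≡ b′
xor-cancelˡ false b b′ e = e
xor-cancelˡ true false false e = refl
xor-cancelˡ true true true e = refl
xor-cancelˡ true false true ()
xor-cancelˡ true true false ()

par-even+even : ∀ y k → par y ≡ false → par k ≡ false → par (y + k) ≡ false
par-even+even y k e1 e2 rewrite par-+ y k | e1 | e2 = refl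

par-even+odd : ∀ y k → par y ≡ false → par k ≡ true → par (y + k) ≡ true
par-even+odd y k e1 e2 rewrite par-+ y k | e1 | e2 = refl

par-odd+even : ∀ y k → par y ≡ true → par k ≡ false → par (y + k) ≡ true
par-odd+even y k e1 e2 rewrite par-+ y k | e1 | e2 = refl

par-odd+odd : ∀ y k → par y ≡ true → par k ≡ true → par (y + k) ≡ false
par-odd+odd y k e1 e2 rewrite par-+ y k | e1 | e2 = refl

par-%-even : ∀ X h .{{_ : NonZero (h + h)}} → par (X % (h + h)) ≡ par X
par-%-even X h = sym (begin
    par X                                ≡⟨ cong par (m≡m%n+[m/n]*n X (h + h)) ⟩
    par (X % (h + h) + k * (h + h))      ≡⟨ cong (λ z → par (X % (h + h) + z)) (*-distribˡ-+ k h h) ⟩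
    par (X % (h + h) + (k * h + k * h))  ≡⟨ par-+ (X % (h + h)) (k * h + k * h) ⟩
    par (X % (h + h)) xor par (k * h + k * h)  ≡⟨ cong (par (X % (h + h)) xor_) (par-double (k * h)) ⟩
    par (X % (h + h)) xor false          ≡⟨ xor-identityʳ _ ⟩
    par (X % (h + h))                    ∎)
  where
    open ≡-Reasoning
    k = X / (h + h)

record CycleThrough {W : Set} (H : W → W → Set) (k : ℕ) (v : W) : Set where
  field
    walk           : ℕ → W
    start          : ℕ
    start<k        : start < k
    walk-start     : walk start ≡ v
    walk-step      : ∀ j → j < k → H (walk j) (walk (suc j))
    walk-period    : walk k ≡ walk 0
    walk-injective : ∀ i j → i < k → j < k → walk i ≡ walk j → i ≡ j

DegreeAtMost2 : {W : Set} → (W → W → Set) → Set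
DegreeAtMost2 H = ∀ u w₁ w₂ w → H u w₁ → H u w₂ → H u w → w₁ ≢ w₂ → w ≡ w₁ ⊎ w ≡ w₂

successor≢predecessor : ∀ {k-1} {i j j′ : Fin (suc k-1)} → 2 ≤ k-1 →
  CycNext (suc k-1) i j → CycNext (suc k-1) j′ i → j ≢ j′
successor≢predecessor 2≤k-1 next prev j≡j′ = distinct 2≤k-1 next prev (cong toℕ j≡j′)
  where
    distinct : ∀ {k-1 a b c} → 2 ≤ k-1 → (b ≡ suc a ⊎ (suc a ≡ suc k-1 × b ≡ 0)) →
               (a ≡ suc c ⊎ (suc c ≡ suc k-1 × a ≡ 0)) → b ≢ c
    distinct {c = c} _ (inj₁ refl) (inj₁ refl) e = <⇒≢ (m<n⇒m<1+n (n<1+n c)) (sym e)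
    distinct 2≤k (inj₁ refl) (inj₂ (e₁ , refl)) e = <⇒≢ 2≤k (trans e (suc-injective e₁))
    distinct 2≤k (inj₂ (e₁ , refl)) (inj₁ refl) refl = <⇒≢ 2≤k (suc-injective e₁)
    distinct 2≤k (inj₂ (e₁ , refl)) (inj₂ (e₂ , refl)) e with suc-injective e₁ | 2≤k
    ... | refl | ()

module CycleFactor {W : Set} (H : W → W → Set) (H-sym : ∀ a b → H a b → H b a)
    (H-degree : DegreeAtMost2 H) (k-1 : ℕ) (2≤k-1 : 2 ≤ k-1) where

  k : ℕ
  k = suc k-1

  successor : (i : Fin k) → Σ (Fin k) (CycNext k i)
  successor i with suc (toℕ i) <? k
  ... | yes i+1<k = fromℕ< i+1<k , inj₁ (toℕ-fromℕ< i+1<k)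
  ... | no i+1≮k  = fz , inj₂ (≤-antisym (toℕ<n i) (≮⇒≥ i+1≮k) , refl)

  predecessor : (i : Fin k) → Σ (Fin k) (λ j → CycNext k j i)
  predecessor i with toℕ i in eq
  ... | zero  = fromℕ< (n<1+n k-1) , inj₂ (cong suc (toℕ-fromℕ< (n<1+n k-1)) , refl)
  ... | suc t = fromℕ< t<k , inj₁ (cong suc (sym (toℕ-fromℕ< t<k)))
    where t<k : t < k
          t<k = <-trans (n<1+n t) (subst (_< k) eq (toℕ<n i))

  module _ (v : W) (C : CycleThrough H k v) where
    open CycleThrough C

    cycle : Fin k → W
    cycle i = walk (toℕ i)

    cycle-injective : ∀ i j → cycle i ≡ cycle j → i ≡ j
    cycle-injective i j e = toℕ-injective (walk-injective (toℕ i) (toℕ j) (toℕ<n i) (toℕ<n j) e)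

    cycle-edge : ∀ i j → CycNext k i j → H (cycle i) (cycle j)
    cycle-edge i j (inj₁ e) = subst (λ z → H (cycle i) (walk z)) (sym e) (walk-step (toℕ i) (toℕ<n i))
    cycle-edge i j (inj₂ (e₁ , e₂)) =
      subst (H (cycle i)) (trans (cong walk e₁) (trans walk-period (cong walk (sym e₂)))) (walk-step (toℕ i) (toℕ<n i))

    cycle-closed : ∀ i w → H (cycle i) w → ∃ λ j → (CycNext k i j ⊎ CycNext k j i) × w ≡ cycle j
    cycle-closed i w i~w with successor i | predecessor i
    ... | jn , next | jp , prev
      with H-degree (cycle i) (cycle jn) (cycle jp) w (cycle-edge i jn next) (H-sym _ _ (cycle-edge jp i prev)) i~w
             (λ e → successor≢predecessor 2≤k-1 next prev (cycle-injective jn jp e))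
    ... | inj₁ e = jn , inj₁ next , e
    ... | inj₂ e = jp , inj₂ prev , e

    cycle-visits : ∃ λ i → cycle i ≡ v
    cycle-visits = fromℕ< start<k , trans (cong walk (toℕ-fromℕ< start<k)) walk-start

  cycles⇒factor : (∀ v → CycleThrough H k v) → IsCkFactor k H
  cycles⇒factor C v = cycle v (C v) , cycle-injective v (C v) , cycle-visits v (C v) , cycle-edge v (C v) , cycle-closed v (C v)

data Side : Set where
  fwd bwd : Side

data Slope : Set where
  up down half : Slope

opposite : Slope → Slope
opposite up   = down
opposite down = up
opposite half = half

odd-slope : Slope → Bool
odd-slope up   = true
odd-slope down = true
odd-slope half = false

data Column : Set where
  wrap first middle last : Column

c0 c1 c2 : Fin 3
c0 = fz
c1 = fs fz
c2 = fs (fs fz)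

byParity : Bool → Fin 3
byParity false = c0
byParity true  = c1

colourOf : Column → Bool → Slope → Fin 3
colourOf wrap   p up   = byParity p
colourOf wrap   p down = byParity p
colourOf wrap   p half = c2
colourOf first  p up   = byParity p
colourOf first  p down = c2
colourOf first  p half = byParity p
colourOf middle p up   = c0
colourOf middle p down = c2
colourOf middle p half = c1
colourOf last   p up   = byParity p
colourOf last   p down = c2
colourOf last   p half = byParity (not p)

data Adjacent : Column → Column → Set where
  wrap-wrap     : Adjacent wrap wrap
  wrap-first    : Adjacent wrap first
  first-middle  : Adjacent first middle
  middle-middle : Adjacent middle middle
  middle-last   : Adjacent middle last
  last-wrap     : Adjacent last wrap

Dir : Set
Dir = Side × Slope

_≟ˢ_ : DecidableEquality Side
fwd ≟ˢ fwd = yes refl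
bwd ≟ˢ bwd = yes refl
fwd ≟ˢ bwd = no λ ()
bwd ≟ˢ fwd = no λ ()

_≟ᵗ_ : DecidableEquality Slope
up   ≟ᵗ up   = yes refl
down ≟ᵗ down = yes refl
half ≟ᵗ half = yes refl
up   ≟ᵗ down = no λ ()
up   ≟ᵗ half = no λ ()
down ≟ᵗ up   = no λ ()
down ≟ᵗ half = no λ ()
half ≟ᵗ up   = no λ ()
half ≟ᵗ down = no λ ()

_≟ᵈ_ : DecidableEquality Dir
_≟ᵈ_ = ≡-dec _≟ˢ_ _≟ᵗ_

all-slopes? : {P : Slope → Set} → (∀ t → Dec (P t)) → Dec (∀ t → P t)
all-slopes? P? = map′ (λ { (pu , pd , ph) → λ { up → pu ; down → pd ; half → ph } })
                      (λ p → p up , p down , p half)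
                      (P? up ×-dec P? down ×-dec P? half)

all-dirs? : {P : Dir → Set} → (∀ d → Dec (P d)) → Dec (∀ d → P d)
all-dirs? P? = map′ (λ { (pf , pb) (fwd , t) → pf t ; (pf , pb) (bwd , t) → pb t })
                    (λ p → (λ t → p (fwd , t)) , (λ t → p (bwd , t)))
                    (all-slopes? (λ t → P? (fwd , t)) ×-dec all-slopes? (λ t → P? (bwd , t)))

AtMostTwoEach : (Dir → Fin 3) → Set
AtMostTwoEach κ = ∀ i d₁ d₂ d → κ d₁ ≡ i → κ d₂ ≡ i → κ d ≡ i → d₁ ≢ d₂ → d ≡ d₁ ⊎ d ≡ d₂

atMostTwoEach? : ∀ κ → Dec (AtMostTwoEach κ)
atMostTwoEach? κ = all? λ i → all-dirs? λ d₁ → all-dirs? λ d₂ → all-dirs? λ d →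
  (κ d₁ ≟ᶠ i) →-dec (κ d₂ ≟ᶠ i) →-dec (κ d ≟ᶠ i) →-dec ¬? (d₁ ≟ᵈ d₂) →-dec ((d ≟ᵈ d₁) ⊎-dec (d ≟ᵈ d₂))

-- The colours of the six edges at a vertex of column type cR and parity p whose
-- preceding column has type cL: a backward edge is coloured from its left end.
localColour : Column → Column → Bool → Dir → Fin 3
localColour cL cR p (fwd , t) = colourOf cR p t
localColour cL cR p (bwd , t) = colourOf cL (p xor odd-slope t) t

localColour-atMostTwoEach : ∀ {cL cR} → Adjacent cL cR → ∀ p → AtMostTwoEach (localColour cL cR p)
localColour-atMostTwoEach adj p = toWitness (by-evaluation adj p)
  where
    by-evaluation : ∀ {cL cR} → Adjacent cL cR → ∀ p → True (atMostTwoEach? (localColour cL cR p))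
    by-evaluation wrap-wrap     false = _
    by-evaluation wrap-wrap     true  = _
    by-evaluation wrap-first    false = _
    by-evaluation wrap-first    true  = _
    by-evaluation first-middle  false = _
    by-evaluation first-middle  true  = _
    by-evaluation middle-middle false = _
    by-evaluation middle-middle true  = _
    by-evaluation middle-last   false = _
    by-evaluation middle-last   true  = _
    by-evaluation last-wrap     false = _
    by-evaluation last-wrap     true  = _

ConnectionSet : (M N h : ℕ) → ℕ → ℕ → Set
ConnectionSet M N h x y = (x ≡ 1 ⊎ x ≡ M ∸ 1) × (y ≡ 1 ⊎ y ≡ N ∸ 1 ⊎ y ≡ h)

Decomposition : (M N h : ℕ) → Set
Decomposition M N h = DecomposesInto (Cay M N (ConnectionSet M N h)) (N ∷ N ∷ M ∷ [])

module Construction (q-2 r : ℕ) where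
  q : ℕ
  q = suc (suc q-2)
  h : ℕ
  h = q + q
  -- Spelt so that N = suc N-1 reduces to h + h.
  N-1 : ℕ
  N-1 = suc ((q-2 + q) + h)
  N : ℕ
  N = suc N-1
  M-1 : ℕ
  M-1 = h + (r + r)
  M : ℕ
  M = suc M-1

  module ZM = Residues M-1
  module ZN = Residues N-1
  open ZM public using () renaming ([_] to [_]ₘ; _⊕_ to _⊕ₘ_)
  open ZN public using () renaming ([_] to [_]ₙ; _⊕_ to _⊕ₙ_)

  Vertex : Set
  Vertex = V M N

  G : Vertex → Vertex → Set
  G = Cay M N (ConnectionSet M N h)

  ⟨_,_⟩ : ℕ → ℕ → Vertex
  ⟨ X , Y ⟩ = [ X ]ₘ , [ Y ]ₙ

  4≤h : 4 ≤ h
  4≤h = +-mono-≤ {2} {q} {2} {q} (s≤s (s≤s z≤n)) (s≤s (s≤s z≤n))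

  h<N-1 : h < N-1
  h<N-1 = s≤s (m≤n+m h (q-2 + q))

  h<N : h < N
  h<N = <-trans h<N-1 (n<1+n N-1)

  h≤M-1 : h ≤ M-1
  h≤M-1 = m≤m+n h (r + r)

  δ : Slope → ℕ
  δ up = 1
  δ down = N-1
  δ half = h

  δ+δ-opposite : ∀ t → δ t + δ (opposite t) ≡ N
  δ+δ-opposite up = refl
  δ+δ-opposite down = +-comm N-1 1
  δ+δ-opposite half = refl

  δ-opposite+δ : ∀ t → δ (opposite t) + δ t ≡ N
  δ-opposite+δ t = trans (+-comm (δ (opposite t)) (δ t)) (δ+δ-opposite t)

  δ<N : ∀ t → δ t < N
  δ<N up = s≤s (s≤s z≤n)
  δ<N down = n<1+n N-1
  δ<N half = h<N

  δ%N : ∀ t → δ t % N ≡ δ t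
  δ%N t = m<n⇒m%n≡m (δ<N t)

  δ-Conn : ∀ t → δ t ≡ 1 ⊎ δ t ≡ N ∸ 1 ⊎ δ t ≡ h
  δ-Conn up = inj₁ refl
  δ-Conn down = inj₂ (inj₁ refl)
  δ-Conn half = inj₂ (inj₂ refl)

  move : Vertex → Side → Slope → Vertex
  move (a , b) fwd t = a ⊕ₘ 1 , b ⊕ₙ δ t
  move (a , b) bwd t = a ⊕ₘ M-1 , b ⊕ₙ δ (opposite t)

  M-1%M : M-1 % M ≡ M-1
  M-1%M = m<n⇒m%n≡m (n<1+n M-1)

  1%M : 1 % M ≡ 1
  1%M = m<n⇒m%n≡m {M} {1} (s≤s (s≤s z≤n))

  M-1+1 : M-1 + 1 ≡ M
  M-1+1 = +-comm M-1 1

  a⊖[a⊕1]≡M-1 : ∀ a → a ⊖ (a ⊕ₘ 1) ≡ M-1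
  a⊖[a⊕1]≡M-1 a = trans (ZM.≡⊕⇒⊖≡ a (a ⊕ₘ 1) M-1 (ZM.⊕-inverse (a ⊕ₘ 1) a 1 M-1 refl refl)) M-1%M

  a⊖[a⊕M-1]≡1 : ∀ a → a ⊖ (a ⊕ₘ M-1) ≡ 1
  a⊖[a⊕M-1]≡1 a = trans (ZM.≡⊕⇒⊖≡ a (a ⊕ₘ M-1) 1 (ZM.⊕-inverse (a ⊕ₘ M-1) a M-1 1 refl M-1+1)) 1%M

  [b⊕δ]⊖b≡δ : ∀ b t → (b ⊕ₙ δ t) ⊖ b ≡ δ t
  [b⊕δ]⊖b≡δ b t = trans (ZN.[a⊕d]⊖a≡d%K b (δ t)) (δ%N t)

  b⊖[b⊕δ-opposite]≡δ : ∀ b t → b ⊖ (b ⊕ₙ δ (opposite t)) ≡ δ t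
  b⊖[b⊕δ-opposite]≡δ b t = trans
      (ZN.≡⊕⇒⊖≡ b (b ⊕ₙ δ (opposite t)) (δ t) (ZN.⊕-inverse (b ⊕ₙ δ (opposite t)) b (δ (opposite t)) (δ t) refl (δ-opposite+δ t)))
      (δ%N t)

  b⊖[b⊕δ]≡δ-opposite : ∀ b t → b ⊖ (b ⊕ₙ δ t) ≡ δ (opposite t)
  b⊖[b⊕δ]≡δ-opposite b t = trans
      (ZN.≡⊕⇒⊖≡ b (b ⊕ₙ δ t) (δ (opposite t)) (ZN.⊕-inverse (b ⊕ₙ δ t) b (δ t) (δ (opposite t)) refl (δ+δ-opposite t)))
      (δ%N (opposite t))

  G-move : ∀ u s t → G u (move u s t)
  G-move (a , b) fwd t = inj₂ (a⊖[a⊕1]≡M-1 a) , subst (λ z → z ≡ 1 ⊎ z ≡ N ∸ 1 ⊎ z ≡ h) (sym (b⊖[b⊕δ]≡δ-opposite b t))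
      (δ-Conn (opposite t))
  G-move (a , b) bwd t = inj₁ (a⊖[a⊕M-1]≡1 a) , subst (λ z → z ≡ 1 ⊎ z ≡ N ∸ 1 ⊎ z ≡ h) (sym (b⊖[b⊕δ-opposite]≡δ b t)) (δ-Conn t)

  move-fwd-bwd : ∀ u t → move (move u fwd t) bwd t ≡ u
  move-fwd-bwd (a , b) t = cong₂ _,_ (trans (ZM.⊕-assoc a 1 M-1) (ZM.⊕-K a))
      (trans (ZN.⊕-assoc b (δ t) (δ (opposite t))) (trans (cong (b ⊕ₙ_) (δ+δ-opposite t)) (ZN.⊕-K b)))

  move-bwd-fwd : ∀ u t → move (move u bwd t) fwd t ≡ u
  move-bwd-fwd (a , b) t = cong₂ _,_ (trans (ZM.⊕-assoc a M-1 1) (trans (cong (a ⊕ₘ_) M-1+1) (ZM.⊕-K a)))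
      (trans (ZN.⊕-assoc b (δ (opposite t)) (δ t)) (trans (cong (b ⊕ₙ_) (δ-opposite+δ t)) (ZN.⊕-K b)))

  slopeOf : ∀ y → y ≡ 1 ⊎ y ≡ N ∸ 1 ⊎ y ≡ h → Σ Slope λ t → y ≡ δ t
  slopeOf y (inj₁ e) = up , e
  slopeOf y (inj₂ (inj₁ e)) = down , e
  slopeOf y (inj₂ (inj₂ e)) = half , e

  G⇒move : ∀ u w → G u w → Σ Side λ s → Σ Slope λ t → w ≡ move u s t
  G⇒move (a , b) (a' , b') (xs , ys) with slopeOf _ ys
  ... | t₀ , e = go xs
    where
      eb : b ≡ b' ⊕ₙ δ t₀
      eb = trans (sym (ZN.b⊕[a⊖b]≡a b b')) (cong (b' ⊕ₙ_) e)
      go : (a ⊖ a') ≡ 1 ⊎ (a ⊖ a') ≡ M ∸ 1 → Σ Side λ s → Σ Slope λ t → (a' , b') ≡ move (a , b) s t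
      go (inj₁ e1) = bwd , t₀ , cong₂ _,_ (ZM.⊕-inverse a a' 1 M-1 (trans (sym (ZM.b⊕[a⊖b]≡a a a')) (cong (a' ⊕ₘ_) e1)) refl)
                                   (ZN.⊕-inverse b b' (δ t₀) (δ (opposite t₀)) eb (δ+δ-opposite t₀))
      go (inj₂ e1) = fwd , opposite t₀ , cong₂ _,_
          (ZM.⊕-inverse a a' M-1 1 (trans (sym (ZM.b⊕[a⊖b]≡a a a')) (cong (a' ⊕ₘ_) e1)) M-1+1)
                                   (ZN.⊕-inverse b b' (δ t₀) (δ (opposite t₀)) eb (δ+δ-opposite t₀))

  columnOfTri : ∀ {X} → Tri (X < h) (X ≡ h) (h < X) → Column
  columnOfTri (tri< _ _ _) = middle
  columnOfTri (tri≈ _ _ _) = last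
  columnOfTri (tri> _ _ _) = wrap

  column : ℕ → Column
  column zero = wrap
  column (suc zero) = first
  column (suc (suc X)) = columnOfTri (<-cmp (suc (suc X)) h)

  column-middle : ∀ X → 2 ≤ X → X < h → column X ≡ middle
  column-middle (suc zero) (s≤s ()) _
  column-middle (suc (suc X)) _ lt with <-cmp (suc (suc X)) h
  ... | tri< _ _ _ = refl
  ... | tri≈ ¬a _ _ = ⊥-elim (¬a lt)
  ... | tri> ¬a _ _ = ⊥-elim (¬a lt)

  column-last : ∀ X → X ≡ h → column X ≡ last
  column-last X refl with <-cmp h h
  ... | tri< _ ¬b _ = ⊥-elim (¬b refl)
  ... | tri≈ _ _ _ = refl
  ... | tri> _ ¬b _ = ⊥-elim (¬b refl)

  column-wrap : ∀ X → h < X → column X ≡ wrap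
  column-wrap zero ()
  column-wrap (suc zero) (s≤s ())
  column-wrap (suc (suc X)) lt with <-cmp (suc (suc X)) h
  ... | tri< _ _ ¬c = ⊥-elim (¬c lt)
  ... | tri≈ _ _ ¬c = ⊥-elim (¬c lt)
  ... | tri> _ _ _ = refl

  slopeOfDec : ∀ {d} → Dec (d ≡ 1) → Dec (d ≡ h) → Slope
  slopeOfDec (yes _) _ = up
  slopeOfDec (no _) (yes _) = half
  slopeOfDec (no _) (no _) = down

  decodeSlope : ℕ → Slope
  decodeSlope d = slopeOfDec (d ≟ 1) (d ≟ h)

  h≢1 : h ≢ 1
  h≢1 e = <⇒≢ (≤-trans (s≤s (s≤s z≤n)) 4≤h) (sym e)

  N-1≢1 : N-1 ≢ 1
  N-1≢1 e = <⇒≢ (≤-trans (s≤s (s≤s z≤n)) (≤-trans 4≤h (<⇒≤ h<N-1))) (sym e)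

  decodeSlope-δ : ∀ t → decodeSlope (δ t) ≡ t
  decodeSlope-δ up with 1 ≟ 1
  ... | yes _ = refl
  ... | no ne = ⊥-elim (ne refl)
  decodeSlope-δ down with N-1 ≟ 1 | N-1 ≟ h
  ... | yes e | _ = ⊥-elim (N-1≢1 e)
  ... | no _ | yes e = ⊥-elim (<⇒≢ h<N-1 (sym e))
  ... | no _ | no _ = refl
  decodeSlope-δ half with h ≟ 1 | h ≟ h
  ... | yes e | _ = ⊥-elim (h≢1 e)
  ... | no _ | yes _ = refl
  ... | no _ | no ne = ⊥-elim (ne refl)

  colourAt : Fin M → Fin N → ℕ → Fin 3
  colourAt x y d = colourOf (column (toℕ x)) (par (toℕ y)) (decodeSlope d)

  colourVia : ∀ {k} → Dec (k ≡ 1) → Vertex → Vertex → Fin 3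
  colourVia (yes _) (a , b) (a' , b') = colourAt a' b' (b ⊖ b')
  colourVia (no _) (a , b) (a' , b') = colourAt a b (b' ⊖ b)

  -- An edge is coloured from its left end: (a , b) is the right end when a ⊖ a' = 1.
  colour : Vertex → Vertex → Fin 3
  colour (a , b) (a' , b') = colourVia ((a ⊖ a') ≟ 1) (a , b) (a' , b')

  colourVia-yes : ∀ {k} (d : Dec (k ≡ 1)) → k ≡ 1 → ∀ a b a' b' → colourVia d (a , b) (a' , b') ≡ colourAt a' b' (b ⊖ b')
  colourVia-yes (yes _) _ a b a' b' = refl
  colourVia-yes (no ne) e a b a' b' = ⊥-elim (ne e)

  colourVia-no : ∀ {k} (d : Dec (k ≡ 1)) → k ≢ 1 → ∀ a b a' b' → colourVia d (a , b) (a' , b') ≡ colourAt a b (b' ⊖ b)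
  colourVia-no (yes e) ne a b a' b' = ⊥-elim (ne e)
  colourVia-no (no _) _ a b a' b' = refl

  fwdColour : Vertex → Slope → Fin 3
  fwdColour (a , b) t = colourOf (column (toℕ a)) (par (toℕ b)) t

  moveColour : Vertex → Side → Slope → Fin 3
  moveColour u fwd t = fwdColour u t
  moveColour u bwd t = fwdColour (move u bwd t) t

  M-1≢1 : M-1 ≢ 1
  M-1≢1 e = <⇒≢ (≤-trans (s≤s (s≤s z≤n)) (≤-trans 4≤h h≤M-1)) (sym e)

  colour-move : ∀ u s t → colour u (move u s t) ≡ moveColour u s t
  colour-move (a , b) fwd t = trans
      (colourVia-no ((a ⊖ (a ⊕ₘ 1)) ≟ 1) (λ e → M-1≢1 (trans (sym (a⊖[a⊕1]≡M-1 a)) e)) a b (a ⊕ₘ 1) (b ⊕ₙ δ t))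
                         (cong (colourOf (column (toℕ a)) (par (toℕ b))) (trans (cong decodeSlope ([b⊕δ]⊖b≡δ b t)) (decodeSlope-δ t)))
  colour-move (a , b) bwd t = trans (colourVia-yes ((a ⊖ (a ⊕ₘ M-1)) ≟ 1) (a⊖[a⊕M-1]≡1 a) a b (a ⊕ₘ M-1) (b ⊕ₙ δ (opposite t)))
                         (cong (colourOf (column (toℕ (a ⊕ₘ M-1))) (par (toℕ (b ⊕ₙ δ (opposite t))))) (trans (cong decodeSlope (b⊖[b⊕δ-opposite]≡δ b t)) (decodeSlope-δ t)))

  colour-sym-fwd : ∀ a t → colour a (move a fwd t) ≡ colour (move a fwd t) a
  colour-sym-fwd a t = trans (colour-move a fwd t)
      (sym (trans (cong (colour w) (sym (move-fwd-bwd a t))) (trans (colour-move w bwd t) (cong (λ z → fwdColour z t) (move-fwd-bwd a t)))))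
    where w = move a fwd t

  colour-sym-bwd : ∀ a t → colour a (move a bwd t) ≡ colour (move a bwd t) a
  colour-sym-bwd a t = trans (colour-move a bwd t) (sym (trans (cong (colour w) (sym (move-bwd-fwd a t))) (colour-move w fwd t)))
    where w = move a bwd t

  colour-sym : ∀ a b → G a b → colour a b ≡ colour b a
  colour-sym a b g with G⇒move a b g
  ... | fwd , t , refl = colour-sym-fwd a t
  ... | bwd , t , refl = colour-sym-bwd a t

  G-sym : ∀ a b → G a b → G b a
  G-sym a b g with G⇒move a b g
  ... | fwd , t , refl = subst (G (move a fwd t)) (move-fwd-bwd a t) (G-move (move a fwd t) bwd t)
  ... | bwd , t , refl = subst (G (move a bwd t)) (move-bwd-fwd a t) (G-move (move a bwd t) fwd t)

  par-N-1 : par N-1 ≡ true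
  par-N-1 with par N-1 | par-double h
  ... | true | _ = refl
  ... | false | ()

  par-h : par h ≡ false
  par-h = par-double q

  par-δ-opposite : ∀ t → par (δ (opposite t)) ≡ odd-slope t
  par-δ-opposite up = par-N-1
  par-δ-opposite down = refl
  par-δ-opposite half = par-h

  par-⊕ₙ : ∀ b d → par (toℕ (b ⊕ₙ d)) ≡ par (toℕ b) xor par d
  par-⊕ₙ b d = trans (cong par (ZN.toℕ-[] (toℕ b + d))) (trans (par-%-even (toℕ b + d) h) (par-+ (toℕ b) d))

  columnBefore columnAt : Vertex → Column
  columnBefore (a , b) = column (toℕ (a ⊕ₘ M-1))
  columnAt (a , b) = column (toℕ a)

  parityAt : Vertex → Bool
  parityAt (a , b) = par (toℕ b)

  moveColour≡localColour : ∀ u s t → moveColour u s t ≡ localColour (columnBefore u) (columnAt u) (parityAt u) (s , t)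
  moveColour≡localColour (a , b) fwd t = refl
  moveColour≡localColour (a , b) bwd t = cong (λ z → colourOf (column (toℕ (a ⊕ₘ M-1))) z t)
      (trans (par-⊕ₙ b (δ (opposite t))) (cong (par (toℕ b) xor_) (par-δ-opposite t)))

  adjacent-suc : ∀ X → Adjacent (column X) (column (suc X))
  adjacent-suc zero = wrap-first
  adjacent-suc (suc zero) rewrite column-middle 2 ≤-refl (≤-trans (s≤s (s≤s (s≤s z≤n))) 4≤h) = first-middle
  adjacent-suc (suc (suc Y)) with <-cmp (suc (suc Y)) h
  ... | tri< lt _ _ with <-cmp (suc (suc (suc Y))) h
  ...   | tri< _ _ _  = middle-middle
  ...   | tri≈ _ _ _  = middle-last
  ...   | tri> _ _ gt' = ⊥-elim (<⇒≱ gt' lt)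
  adjacent-suc (suc (suc Y)) | tri≈ _ e _ rewrite column-wrap (suc (suc (suc Y))) (≤-reflexive (cong suc (sym e))) = last-wrap
  adjacent-suc (suc (suc Y)) | tri> _ _ lt rewrite column-wrap (suc (suc (suc Y))) (≤-trans lt (n≤1+n _)) = wrap-wrap

  adjacent-wrap : ∀ r₀ → Adjacent (column (h + (r₀ + r₀))) wrap
  adjacent-wrap zero rewrite column-last (h + 0) (+-identityʳ h) = last-wrap
  adjacent-wrap (suc r') rewrite column-wrap (h + (suc r' + suc r')) (m<m+n h (s≤s z≤n)) = wrap-wrap

  adjacent-columns : ∀ u → Adjacent (columnBefore u) (columnAt u)
  adjacent-columns (a , b) rewrite ZM.toℕ-[] (toℕ a + M-1) = adjacent-at (toℕ a) (toℕ<n a)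
    where
      adjacent-at : ∀ X → X < M → Adjacent (column ((X + M-1) % M)) (column X)
      adjacent-at zero _ rewrite M-1%M = adjacent-wrap r
      adjacent-at (suc X) lt = subst (λ z → Adjacent (column z) (column (suc X))) (sym e) (adjacent-suc X)
        where
          e : (suc X + M-1) % M ≡ X
          e = trans (cong (_% M) (sym (+-suc X M-1))) (trans ([m+n]%n≡m%n X M) (m<n⇒m%n≡m (<-trans (n<1+n X) lt)))

  Class : Fin 3 → Vertex → Vertex → Set
  Class i a b = G a b × colour a b ≡ i

  Class-degree : ∀ i → DegreeAtMost2 (Class i)
  Class-degree i u w₁ w₂ w (g₁ , e₁) (g₂ , e₂) (g , e) w₁≢w₂ with G⇒move u w₁ g₁ | G⇒move u w₂ g₂ | G⇒move u w g
  ... | s₁ , t₁ , refl | s₂ , t₂ , refl | s , t , refl =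
    ⊎-map (cong moveTo) (cong moveTo)
      (localColour-atMostTwoEach (adjacent-columns u) (parityAt u) i (s₁ , t₁) (s₂ , t₂) (s , t)
        (local≡ s₁ t₁ e₁) (local≡ s₂ t₂ e₂) (local≡ s t e) (λ eq → w₁≢w₂ (cong moveTo eq)))
    where
      moveTo : Dir → Vertex
      moveTo (s , t) = move u s t
      local≡ : ∀ s t → colour u (move u s t) ≡ i → localColour (columnBefore u) (columnAt u) (parityAt u) (s , t) ≡ i
      local≡ s t eq = trans (sym (moveColour≡localColour u s t)) (trans (sym (colour-move u s t)) eq)

module Cycles (q-2 r : ℕ) where
  open Construction q-2 r
  open ≡-Reasoning

  h-1 : ℕ
  h-1 = suc (q-2 + q)

  par-[]ₙ : ∀ Y → par (toℕ [ Y ]ₙ) ≡ par Y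
  par-[]ₙ Y = trans (cong par (ZN.toℕ-[] Y)) (par-%-even Y h)

  fwdColour-⟨⟩ : ∀ X Y t → X < M → fwdColour ⟨ X , Y ⟩ t ≡ colourOf (column X) (par Y) t
  fwdColour-⟨⟩ X Y t lt = cong₂ (λ a b → colourOf (column a) b t) (ZM.toℕ-[]-< X lt) (par-[]ₙ Y)

  move-fwd-⟨⟩ : ∀ X Y t → move ⟨ X , Y ⟩ fwd t ≡ ⟨ suc X , Y + δ t ⟩
  move-fwd-⟨⟩ X Y t = cong₂ _,_ (trans (ZM.[]-⊕ X 1) (cong [_]ₘ (+-comm X 1))) (ZN.[]-⊕ Y (δ t))

  Class-sym : ∀ i a b → Class i a b → Class i b a
  Class-sym i a b (g , e) = G-sym a b g , trans (sym (colour-sym a b g)) e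

  fwd-edge : ∀ i X Y t → X < M → colourOf (column X) (par Y) t ≡ i → Class i ⟨ X , Y ⟩ ⟨ suc X , Y + δ t ⟩
  fwd-edge i X Y t lt e = subst (Class i ⟨ X , Y ⟩) (move-fwd-⟨⟩ X Y t)
      (G-move ⟨ X , Y ⟩ fwd t , trans (colour-move ⟨ X , Y ⟩ fwd t) (trans (fwdColour-⟨⟩ X Y t lt) e))

  fwd-edge′ : ∀ i X Y t {a b} → X < M → colourOf (column X) (par Y) t ≡ i → a ≡ ⟨ X , Y ⟩ → b ≡ ⟨ suc X , Y + δ t ⟩ → Class i a b
  fwd-edge′ i X Y t lt e refl refl = fwd-edge i X Y t lt e

  bwd-edge′ : ∀ i X Y t {a b} → X < M → colourOf (column X) (par Y) t ≡ i → a ≡ ⟨ suc X , Y + δ t ⟩ → b ≡ ⟨ X , Y ⟩ → Class i a b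
  bwd-edge′ i X Y t lt e refl refl = Class-sym i ⟨ X , Y ⟩ ⟨ suc X , Y + δ t ⟩ (fwd-edge i X Y t lt e)

  ⟨⟩-congʳ : ∀ X {Y Y'} → Y ≡ Y' → ⟨ X , Y ⟩ ≡ ⟨ X , Y' ⟩
  ⟨⟩-congʳ X refl = refl

  ⟨⟩-+N : ∀ X Y → ⟨ X , Y + N ⟩ ≡ ⟨ X , Y ⟩
  ⟨⟩-+N X Y = cong₂ _,_ refl (ZN.[+K] Y)

  ⟨⟩-+kN : ∀ X Y k → ⟨ X , Y + k * N ⟩ ≡ ⟨ X , Y ⟩
  ⟨⟩-+kN X Y k = cong₂ _,_ refl (ZN.[+k*K] Y k)

  ⟨⟩-+M : ∀ X Y → ⟨ X + M , Y ⟩ ≡ ⟨ X , Y ⟩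
  ⟨⟩-+M X Y = cong₂ _,_ (ZM.[+K] X) refl

  ⟨⟩-≡+N : ∀ X Y {Y'} → Y' ≡ Y + N → ⟨ X , Y' ⟩ ≡ ⟨ X , Y ⟩
  ⟨⟩-≡+N X Y refl = ⟨⟩-+N X Y

  plusBit : ℕ → Bool → ℕ
  plusBit x false = x
  plusBit x true = suc x

  zigzag : ℕ → ℕ → ℕ → Vertex
  zigzag x y0 j = ⟨ plusBit x (par j) , y0 + j ⟩

  par-N : par N ≡ false
  par-N = par-double h

  zigzag-cycle : ∀ x y0 v → x < M → column x ≡ wrap → ∀ st → st < N → zigzag x y0 st ≡ v → CycleThrough (Class (byParity (par y0))) N v
  zigzag-cycle x y0 v x<M gx st st< hit = record
    { walk = zigzag x y0 ; start = st ; start<k = st< ; walk-start = hit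
    ; walk-step = step
    ; walk-period = trans (cong (λ b → ⟨ plusBit x b , y0 + N ⟩) par-N) (trans (⟨⟩-+N x y0) (⟨⟩-congʳ x (sym (+-identityʳ y0))))
    ; walk-injective = λ i j i< j< e → ZN.[]-cancelˡ y0 i j i< j< (cong proj₂ e) }
    where
      step : ∀ j → j < N → Class (byParity (par y0)) (zigzag x y0 j) (zigzag x y0 (suc j))
      step j _ with par j in pj
      ... | false = fwd-edge′ _ x (y0 + j) up x<M
                      (trans (cong (λ z → colourOf z (par (y0 + j)) up) gx) (cong byParity (trans (par-+ y0 j) (trans (cong (par y0 xor_) pj) (xor-identityʳ (par y0))))))
                      refl (⟨⟩-congʳ (suc x) (trans (+-suc y0 j) (+-comm 1 (y0 + j))))
      ... | true = bwd-edge′ _ x (y0 + suc j) down x<M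
                      (trans (cong (λ z → colourOf z (par (y0 + suc j)) down) gx) (cong byParity (trans (par-+ y0 (suc j)) (trans (cong (λ z → par y0 xor not z) pj) (xor-identityʳ (par y0))))))
                      (sym (⟨⟩-≡+N (suc x) (y0 + j) e1)) refl
        where
          e1 : y0 + suc j + N-1 ≡ y0 + j + N
          e1 = trans (cong (_+ N-1) (+-suc y0 j)) (sym (+-suc (y0 + j) N-1))

  -- Partial sums of the steps h, −1 (h times), h, h, …; the extra N avoids truncated subtraction.
  longOffset : ℕ → ℕ
  longOffset zero = 0
  longOffset (suc j) with j ≤? h
  ... | yes _ = N + (h ∸ j)
  ... | no _ = N + h * (j ∸ h)

  longOffset-≤h : ∀ j → j ≤ h → longOffset (suc j) ≡ N + (h ∸ j)
  longOffset-≤h j le with j ≤? h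
  ... | yes _ = refl
  ... | no nle = ⊥-elim (nle le)

  longOffset-≥h : ∀ j → h ≤ j → longOffset (suc j) ≡ N + h * (j ∸ h)
  longOffset-≥h j le with j ≤? h
  ... | yes le' with ≤-antisym le' le
  ...   | refl = cong (N +_) (trans (n∸n≡0 h) (sym (trans (cong (h *_) (n∸n≡0 h)) (*-zeroʳ h))))
  longOffset-≥h j le | no _ = refl

  longWalk : ℕ → ℕ → Vertex
  longWalk y j = ⟨ j , y + longOffset j ⟩

  colourOf-down : ∀ X p → 1 ≤ X → X ≤ h → colourOf (column X) p down ≡ c2
  colourOf-down (suc zero) p _ _ = refl
  colourOf-down (suc (suc X)) p _ le with <-cmp (suc (suc X)) h
  ... | tri< _ _ _ = refl
  ... | tri≈ _ _ _ = refl
  ... | tri> _ _ c' = ⊥-elim (<⇒≱ c' le)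

  colourOf-half-wrap : ∀ X p → h < X → colourOf (column X) p half ≡ c2
  colourOf-half-wrap X p lt rewrite column-wrap X lt = refl

  long-cycle : ∀ y v st → st < M → longWalk y st ≡ v → CycleThrough (Class c2) M v
  long-cycle y v st st< hit = record
    { walk = longWalk y ; start = st ; start<k = st< ; walk-start = hit
    ; walk-step = step
    ; walk-period = closes
    ; walk-injective = λ i j i< j< e → ZM.[]-cancelˡ 0 i j i< j< (cong proj₁ e) }
    where
      step-after-0 : ∀ j → suc j < M → Dec (j < h) → Class c2 (longWalk y (suc j)) (longWalk y (suc (suc j)))
      step-after-0 j lt (yes j<h) = fwd-edge′ c2 (suc j) (y + longOffset (suc j)) down lt (colourOf-down (suc j) _ (s≤s z≤n) j<h)
          refl
                     (sym (⟨⟩-≡+N (suc (suc j)) (y + longOffset (suc (suc j))) eq))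
        where
          a = h ∸ suc j
          eq : y + longOffset (suc j) + N-1 ≡ y + longOffset (suc (suc j)) + N
          eq = begin
            y + longOffset (suc j) + N-1 ≡⟨ cong (λ z → y + z + N-1) (longOffset-≤h j (<⇒≤ j<h)) ⟩
            y + (N + (h ∸ j)) + N-1 ≡⟨ cong (λ z → y + (N + z) + N-1) (+-∸-assoc 1 j<h) ⟩
            y + (N + suc a) + N-1 ≡⟨ solve 3 (λ y' a' n' → y' :+ ((con 1 :+ n') :+ (con 1 :+ a')) :+ n' := y' :+ ((con 1 :+ n') :+ a') :+ (con 1 :+ n')) refl y a N-1 ⟩
            y + (N + a) + N ≡⟨ cong (λ z → y + z + N) (sym (longOffset-≤h (suc j) j<h)) ⟩
            y + longOffset (suc (suc j)) + N ∎
      step-after-0 j lt (no j≮h) = fwd-edge′ c2 (suc j) (y + longOffset (suc j)) half lt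
          (colourOf-half-wrap (suc j) _ (s≤s (≮⇒≥ j≮h))) refl
                     (⟨⟩-congʳ (suc (suc j)) eq)
        where
          k = j ∸ h
          eq : y + longOffset (suc (suc j)) ≡ y + longOffset (suc j) + h
          eq = begin
            y + longOffset (suc (suc j)) ≡⟨ cong (y +_) (longOffset-≥h (suc j) (≤-trans (≮⇒≥ j≮h) (n≤1+n j))) ⟩
            y + (N + h * (suc j ∸ h)) ≡⟨ cong (λ z → y + (N + h * z)) (+-∸-assoc 1 (≮⇒≥ j≮h)) ⟩
            y + (N + h * suc k) ≡⟨ solve 4 (λ y' n h' k' → y' :+ (n :+ h' :* (con 1 :+ k')) := y' :+ (n :+ h' :* k') :+ h') refl y N h k ⟩
            y + (N + h * k) + h ≡⟨ cong (λ z → y + z + h) (sym (longOffset-≥h j (≮⇒≥ j≮h))) ⟩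
            y + longOffset (suc j) + h ∎
      step : ∀ j → j < M → Class c2 (longWalk y j) (longWalk y (suc j))
      step zero _ = fwd-edge′ c2 0 (y + 0) half (s≤s z≤n) refl refl
                     (⟨⟩-≡+N 1 (y + 0 + h) (trans (cong (y +_) (longOffset-≤h 0 z≤n)) (solve 3 (λ y' n' h' → y' :+ ((con 1 :+ n') :+ h') := y' :+ con 0 :+ h' :+ (con 1 :+ n')) refl y N-1 h)))
      step (suc j) lt = step-after-0 j lt (j <? h)
      closes : longWalk y M ≡ longWalk y 0
      closes = begin
        ⟨ M , y + longOffset M ⟩ ≡⟨ ⟨⟩-congʳ M (cong (y +_) (longOffset-≥h M-1 h≤M-1)) ⟩
        ⟨ M , y + (N + h * (M-1 ∸ h)) ⟩ ≡⟨ ⟨⟩-congʳ M (cong (λ z → y + (N + h * z)) (m+n∸m≡n h (r + r))) ⟩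
        ⟨ M , y + (N + h * (r + r)) ⟩ ≡⟨ ⟨⟩-congʳ M (solve 3 (λ y' h' r' → y' :+ ((h' :+ h') :+ h' :* (r' :+ r')) := y' :+ con 0 :+ (con 1 :+ r') :* (h' :+ h')) refl y h r) ⟩
        ⟨ M , y + 0 + suc r * N ⟩ ≡⟨ ⟨⟩-+kN M (y + 0) (suc r) ⟩
        ⟨ 0 + M , y + 0 ⟩ ≡⟨ ⟨⟩-+M 0 (y + 0) ⟩
        ⟨ 0 , y + 0 ⟩ ∎

  par-h-1 : par h-1 ≡ true
  par-h-1 with par h-1 | par-h
  ... | true | _ = refl
  ... | false | ()

  par-N-2 : par (N-1 ∸ 1) ≡ false
  par-N-2 with par (N-1 ∸ 1) | par-N-1
  ... | false | _ = refl
  ... | true | ()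

  colourOf-column-middle : ∀ X → 2 ≤ X → X < h → ∀ p t → colourOf (column X) p t ≡ colourOf middle p t
  colourOf-column-middle X a b p t rewrite column-middle X a b = refl

  data AView (j : ℕ) : Set where
    a-up : j < h → AView j
    a-down : ∀ t → t < h → j ≡ h + t → AView j

  a-view : ∀ j → j < N → AView j
  a-view j lt with j <? h
  ... | yes jh = a-up jh
  ... | no njh = a-down (j ∸ h) (+-cancelˡ-< h (j ∸ h) h (subst (_< h + h) (sym (m+[n∸m]≡n (≮⇒≥ njh))) lt))
      (sym (m+[n∸m]≡n (≮⇒≥ njh)))

  walkA-cases : ∀ {j} → ℕ → Dec (j < h) → Dec (j < N) → Vertex
  walkA-cases {j} y (yes _) _ = ⟨ suc j , y + j ⟩
  walkA-cases {j} y (no _) (yes _) = ⟨ suc h ∸ (j ∸ h) , y + (N-1 ∸ (j ∸ h)) ⟩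
  walkA-cases {j} y (no _) (no _) = ⟨ 1 , y ⟩

  walkA : ℕ → ℕ → Vertex
  walkA y j = walkA-cases {j} y (j <? h) (j <? N)

  walkA-up : ∀ y j → j < h → walkA y j ≡ ⟨ suc j , y + j ⟩
  walkA-up y j lt with j <? h
  ... | yes _ = refl
  ... | no n = ⊥-elim (n lt)

  walkA-down : ∀ y t → t < h → walkA y (h + t) ≡ ⟨ suc h ∸ t , y + (N-1 ∸ t) ⟩
  walkA-down y t lt with (h + t) <? h | (h + t) <? N
  ... | yes p | _ = ⊥-elim (m+n≮m h t p)
  ... | no _ | yes _ rewrite m+n∸m≡n h t = refl
  ... | no _ | no n = ⊥-elim (n (+-monoʳ-< h lt))

  walkA-N : ∀ y → walkA y N ≡ ⟨ 1 , y ⟩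
  walkA-N y with N <? h | N <? N
  ... | yes p | _ = ⊥-elim (<-asym p h<N)
  ... | no _ | yes p = ⊥-elim (<-irrefl refl p)
  ... | no _ | no _ = refl

  offsetA : ∀ j → AView j → ℕ
  offsetA j (a-up _) = j
  offsetA j (a-down t _ _) = N-1 ∸ t

  walkA-offset : ∀ y j (v : AView j) → proj₂ (walkA y j) ≡ [ y + offsetA j v ]ₙ
  walkA-offset y j (a-up lt) = cong proj₂ (walkA-up y j lt)
  walkA-offset y j (a-down t lt refl) = cong proj₂ (walkA-down y t lt)

  h≤N-1∸t : ∀ t → t < h → h ≤ N-1 ∸ t
  h≤N-1∸t t lt = subst (_≤ N-1 ∸ t) (m+n∸m≡n h-1 h) (∸-monoʳ-≤ (h-1 + h) (≤-pred lt))

  offsetA<N : ∀ j v → offsetA j v < N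
  offsetA<N j (a-up lt) = <-trans lt h<N
  offsetA<N j (a-down t _ _) = s≤s (m∸n≤m N-1 t)

  offsetA-injective : ∀ i j vi vj → offsetA i vi ≡ offsetA j vj → i ≡ j
  offsetA-injective i j (a-up _) (a-up _) e = e
  offsetA-injective i j (a-up li) (a-down t lt _) e = ⊥-elim (<⇒≱ li (subst (h ≤_) (sym e) (h≤N-1∸t t lt)))
  offsetA-injective i j (a-down t lt _) (a-up lj) e = ⊥-elim (<⇒≱ lj (subst (h ≤_) e (h≤N-1∸t t lt)))
  offsetA-injective i j (a-down t lt refl) (a-down t' lt' refl) e = cong (h +_)
      (∸-cancelˡ-≡ (≤-trans (<⇒≤ lt) (<⇒≤ h<N-1)) (≤-trans (<⇒≤ lt') (<⇒≤ h<N-1)) e)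

  ≤h⇒<M : ∀ X → X ≤ h → X < M
  ≤h⇒<M X le = s≤s (≤-trans le h≤M-1)

  cycleA : ∀ y v → par y ≡ false → ∀ st → st < N → walkA y st ≡ v → CycleThrough (Class c0) N v
  cycleA y v py st st< hit = record
    { walk = walkA y ; start = st ; start<k = st< ; walk-start = hit
    ; walk-step = step
    ; walk-period = trans (walkA-N y) (sym (trans (walkA-up y 0 (≤-trans (s≤s z≤n) 4≤h)) (⟨⟩-congʳ 1 (+-identityʳ y))))
    ; walk-injective = λ i j i< j< e → offsetA-injective i j (a-view i i<) (a-view j j<)
              (ZN.[]-cancelˡ y _ _ (offsetA<N i (a-view i i<)) (offsetA<N j (a-view j j<))
                (trans (sym (walkA-offset y i (a-view i i<))) (trans (cong proj₂ e) (walkA-offset y j (a-view j j<))))) }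
    where
      step-up : ∀ j → j < h → Dec (suc j < h) → Class c0 (walkA y j) (walkA y (suc j))
      step-up zero lt (yes lt') = fwd-edge′ c0 1 (y + 0) up (≤h⇒<M 1 (≤-trans (s≤s z≤n) 4≤h))
                      (cong byParity (par-even+even y 0 py refl)) (walkA-up y 0 lt) (trans (walkA-up y 1 lt') (⟨⟩-congʳ 2 (cong (_+ 1) (sym (+-identityʳ y)))))
      step-up (suc j) lt (yes lt') = fwd-edge′ c0 (suc (suc j)) (y + suc j) up (≤h⇒<M (suc (suc j)) lt)
                      (colourOf-column-middle (suc (suc j)) (s≤s (s≤s z≤n)) lt' _ up) (walkA-up y (suc j) lt)
                      (trans (walkA-up y (suc (suc j)) lt') (⟨⟩-congʳ (suc (suc (suc j))) (trans (+-suc y (suc j)) (+-comm 1 (y + suc j)))))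
      step-up j lt (no nlt) with ≤-antisym lt (≮⇒≥ nlt)
      ... | refl = fwd-edge′ c0 h (y + h-1) half (≤h⇒<M h ≤-refl)
                      (trans (cong (λ z → colourOf z (par (y + h-1)) half) (column-last h refl)) (cong (λ z → byParity (not z)) (par-even+odd y h-1 py par-h-1)))
                      (walkA-up y h-1 lt)
                      (trans (cong (walkA y) (sym (+-identityʳ h))) (trans (walkA-down y 0 (≤-trans (s≤s z≤n) 4≤h)) (⟨⟩-congʳ (suc h) (sym (+-assoc y h-1 h)))))
      colour-down-step : ∀ t → suc t < h → colourOf (column (h ∸ t)) (par (y + (N-1 ∸ suc t))) up ≡ c0
      colour-down-step zero _ rewrite column-last h refl | par-even+even y (N-1 ∸ 1) py par-N-2 = refl
      colour-down-step (suc t') lt' rewrite column-middle (h ∸ suc t') (m+n≤o⇒m≤o∸n 2 lt') (∸-monoʳ-< (s≤s z≤n) (<⇒≤ (<-trans (n<1+n (suc t')) lt'))) = refl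
      step-down : ∀ t → t < h → Dec (suc t < h) → Class c0 (walkA y (h + t)) (walkA y (suc (h + t)))
      step-down t lt (yes lt') = bwd-edge′ c0 (h ∸ t) (y + (N-1 ∸ suc t)) up (≤h⇒<M _ (m∸n≤m h t)) (colour-down-step t lt')
                      (trans (walkA-down y t lt) (cong₂ ⟨_,_⟩ (+-∸-assoc 1 (<⇒≤ lt)) (trans (cong (y +_) (+-∸-assoc 1 (≤-trans (<⇒≤ lt') (<⇒≤ h<N-1)))) (trans (+-suc y _) (+-comm 1 _)))))
                      (trans (cong (walkA y) (sym (+-suc h t))) (walkA-down y (suc t) lt'))
      step-down t lt (no nlt) with ≤-antisym (≤-pred lt) (≤-pred (≮⇒≥ nlt))
      ... | refl = bwd-edge′ c0 1 y half (≤h⇒<M 1 (≤-trans (s≤s z≤n) 4≤h)) (cong byParity py)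
                      (trans (walkA-down y h-1 lt) (cong₂ ⟨_,_⟩ (m+n∸n≡m 2 h-1) (cong (y +_) (m+n∸m≡n h-1 h))))
                      (trans (cong (walkA y) (sym (+-suc h h-1))) (walkA-N y))
      step : ∀ j → j < N → Class c0 (walkA y j) (walkA y (suc j))
      step j lt with a-view j lt
      ... | a-up jh = step-up j jh (suc j <? h)
      ... | a-down t th refl = step-down t th (suc t <? h)

  hIfOdd : ℕ → ℕ
  hIfOdd k = if par k then h else 0

  hIfOdd-ss : ∀ k → hIfOdd (suc (suc k)) ≡ hIfOdd k
  hIfOdd-ss k with par k
  ... | true = refl
  ... | false = refl

  par-hIfOdd : ∀ k → par (hIfOdd k) ≡ false
  par-hIfOdd k with par k
  ... | true = par-h
  ... | false = refl

  ⟨⟩-hIfOdd-suc : ∀ X Z k → ⟨ X , Z + hIfOdd k + h ⟩ ≡ ⟨ X , Z + hIfOdd (suc k) ⟩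
  ⟨⟩-hIfOdd-suc X Z k with par k
  ... | true = ⟨⟩-≡+N X (Z + 0) (trans (+-assoc Z h h) (trans (cong (Z +_) refl) (cong (_+ N) (sym (+-identityʳ Z)))))
  ... | false = ⟨⟩-congʳ X (trans (cong (_+ h) (+-identityʳ Z)) refl)

  data BView (j : ℕ) : Set where
    b-zero : j ≡ 0 → BView j
    b-up : ∀ j' → j' < h → j ≡ suc j' → BView j
    b-down : ∀ t' → suc t' < h → j ≡ h + suc t' → BView j

  b-view : ∀ j → j < N → BView j
  b-view zero _ = b-zero refl
  b-view (suc j) lt with j <? h
  ... | yes jh = b-up j jh refl
  ... | no njh = b-down (j ∸ h) tl (trans (cong suc (sym (m+[n∸m]≡n (≮⇒≥ njh)))) (sym (+-suc h (j ∸ h))))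
    where
      tl : suc (j ∸ h) < h
      tl = +-cancelˡ-< h (suc (j ∸ h)) h
          (subst (_< h + h) (trans (cong suc (sym (m+[n∸m]≡n (≮⇒≥ njh)))) (sym (+-suc h (j ∸ h)))) lt)

  walkB-cases : ∀ {j} → ℕ → Dec (j < h) → Dec (suc j < N) → Vertex
  walkB-cases {j} y (yes _) _ = ⟨ suc (suc j) , y + 1 + hIfOdd (suc (suc j)) ⟩
  walkB-cases {j} y (no _) (yes _) = ⟨ suc h ∸ (suc j ∸ h) , y + hIfOdd (suc j ∸ h) ⟩
  walkB-cases {j} y (no _) (no _) = ⟨ 1 , y ⟩

  walkB : ℕ → ℕ → Vertex
  walkB y zero = ⟨ 1 , y ⟩
  walkB y (suc j) = walkB-cases {j} y (j <? h) (suc j <? N)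

  walkB-up : ∀ y j' → j' < h → walkB y (suc j') ≡ ⟨ suc (suc j') , y + 1 + hIfOdd (suc (suc j')) ⟩
  walkB-up y j' lt with j' <? h
  ... | yes _ = refl
  ... | no n = ⊥-elim (n lt)

  walkB-down′ : ∀ y t' → suc t' < h → walkB y (suc (h + t')) ≡ ⟨ h ∸ t' , y + hIfOdd (suc t') ⟩
  walkB-down′ y t' lt with (h + t') <? h | suc (h + t') <? N
  ... | yes p | _ = ⊥-elim (m+n≮m h t' p)
  ... | no _ | yes _ rewrite +-∸-assoc 1 (m≤m+n h t') | m+n∸m≡n h t' = refl
  ... | no _ | no n = ⊥-elim (n (subst (_< N) (+-suc h t') (+-monoʳ-< h lt)))

  walkB-down : ∀ y t' → suc t' < h → walkB y (h + suc t') ≡ ⟨ h ∸ t' , y + hIfOdd (suc t') ⟩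
  walkB-down y t' lt = trans (cong (walkB y) (+-suc h t')) (walkB-down′ y t' lt)

  walkB-N : ∀ y → walkB y N ≡ ⟨ 1 , y ⟩
  walkB-N y with N-1 <? h | N <? N
  ... | yes p | _ = ⊥-elim (<-asym p h<N-1)
  ... | no _ | yes p = ⊥-elim (<-irrefl refl p)
  ... | no _ | no _ = refl

  columnB : ∀ j → BView j → ℕ
  columnB j (b-zero _) = 0
  columnB j (b-up j' _ _) = suc j'
  columnB j (b-down t' _ _) = h ∸ suc t'

  offsetB : ∀ j → BView j → ℕ
  offsetB j (b-zero _) = 0
  offsetB j (b-up j' _ _) = 1 + hIfOdd (suc (suc j'))
  offsetB j (b-down t' _ _) = hIfOdd (suc t')

  walkB-form : ∀ y j (v : BView j) → walkB y j ≡ ⟨ suc (columnB j v) , y + offsetB j v ⟩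
  walkB-form y j (b-zero refl) = ⟨⟩-congʳ 1 (sym (+-identityʳ y))
  walkB-form y j (b-up j' lt refl) = trans (walkB-up y j' lt) (⟨⟩-congʳ (suc (suc j')) (+-assoc y 1 _))
  walkB-form y j (b-down t' lt refl) = trans (walkB-down y t' lt)
      (cong (λ z → ⟨ z , y + hIfOdd (suc t') ⟩) (+-∸-assoc 1 (<⇒≤ lt)))

  columnB<M : ∀ j v → columnB j v < M
  columnB<M j (b-zero _) = s≤s z≤n
  columnB<M j (b-up j' lt _) = ≤h⇒<M _ lt
  columnB<M j (b-down t' _ _) = ≤h⇒<M _ (m∸n≤m h (suc t'))

  par-offsetB : ∀ j v → par (offsetB j v) ≡ false ⊎ (par (offsetB j v) ≡ true × ∃ λ j' → j ≡ suc j' × j' < h)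
  par-offsetB j (b-zero _) = inj₁ refl
  par-offsetB j (b-up j' lt eq) = inj₂ (cong not (par-hIfOdd (suc (suc j'))) , j' , eq , lt)
  par-offsetB j (b-down t' _ _) = inj₁ (par-hIfOdd (suc t'))

  columnB-parity-injective : ∀ i j vi vj → columnB i vi ≡ columnB j vj → par (offsetB i vi) ≡ par (offsetB j vj) → i ≡ j
  columnB-parity-injective i j (b-zero refl) (b-zero refl) _ _ = refl
  columnB-parity-injective i j (b-zero _) (b-up j' _ _) _ p rewrite par-hIfOdd (suc (suc j')) = contradiction p λ ()
  columnB-parity-injective i j (b-up j' _ _) (b-zero _) _ p rewrite par-hIfOdd (suc (suc j')) = contradiction p λ ()
  columnB-parity-injective i j (b-zero _) (b-down t' lt _) x _ = ⊥-elim (m>n⇒m∸n≢0 lt (sym x))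
  columnB-parity-injective i j (b-down t' lt _) (b-zero _) x _ = ⊥-elim (m>n⇒m∸n≢0 lt x)
  columnB-parity-injective i j (b-up j₁ _ refl) (b-up j₂ _ refl) x _ = x
  columnB-parity-injective i j (b-up j' _ _) (b-down t' _ _) _ p rewrite par-hIfOdd (suc (suc j')) | par-hIfOdd (suc t') = contradiction
      p λ ()
  columnB-parity-injective i j (b-down t' _ _) (b-up j' _ _) _ p rewrite par-hIfOdd (suc (suc j')) | par-hIfOdd (suc t') = contradiction
      p λ ()
  columnB-parity-injective i j (b-down t₁ l₁ refl) (b-down t₂ l₂ refl) x _ = cong (λ z → h + suc z)
      (suc-injective (∸-cancelˡ-≡ (<⇒≤ l₁) (<⇒≤ l₂) x))

  colourOf-half-B : ∀ y → par y ≡ true → ∀ X → 2 ≤ X → X ≤ h → colourOf (column X) (par (y + 1 + hIfOdd X)) half ≡ c1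
  colourOf-half-B y py X a b with <-cmp X h
  ... | tri< lt _ _ = colourOf-column-middle X a lt _ half
  ... | tri> _ _ c' = ⊥-elim (<⇒≱ c' b)
  ... | tri≈ _ refl _ rewrite column-last h refl | par-h | +-identityʳ (y + 1) | par-odd+odd y 1 py refl = refl

  cycleB : ∀ y v → par y ≡ true → ∀ st → st < N → walkB y st ≡ v → CycleThrough (Class c1) N v
  cycleB y v py st st< hit = record
    { walk = walkB y ; start = st ; start<k = st< ; walk-start = hit
    ; walk-step = step
    ; walk-period = walkB-N y
    ; walk-injective = λ i j i< j< eq → walkB-injective i j (b-view i i<) (b-view j j<)
                (trans (sym (walkB-form y i (b-view i i<))) (trans eq (walkB-form y j (b-view j j<)))) }
    where
      walkB-injective : ∀ i j vi vj → ⟨ suc (columnB i vi) , y + offsetB i vi ⟩ ≡ ⟨ suc (columnB j vj) , y + offsetB j vj ⟩ → i ≡ j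
      walkB-injective i j vi vj eq = columnB-parity-injective i j vi vj
          (ZM.[]-cancelˡ 1 _ _ (columnB<M i vi) (columnB<M j vj) (cong proj₁ eq))
         (xor-cancelˡ (par y) _ _ (trans (sym (par-+ y (offsetB i vi))) (trans (sym (par-[]ₙ (y + offsetB i vi))) (trans (cong (λ z → par (toℕ (proj₂ z))) eq) (trans (par-[]ₙ (y + offsetB j vj)) (par-+ y (offsetB j vj)))))))

      step-up : ∀ j' → j' < h → Dec (suc j' < h) → Class c1 (walkB y (suc j')) (walkB y (suc (suc j')))
      step-up j' lt (yes lt') = fwd-edge′ c1 (suc (suc j')) (y + 1 + hIfOdd (suc (suc j'))) half (≤h⇒<M _ lt')
                      (colourOf-half-B y py (suc (suc j')) (s≤s (s≤s z≤n)) lt') (walkB-up y j' lt)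
                      (trans (walkB-up y (suc j') lt') (sym (⟨⟩-hIfOdd-suc (suc (suc (suc j'))) (y + 1) (suc (suc j')))))
      step-up j' lt (no nlt) with ≤-antisym lt (≮⇒≥ nlt)
      ... | refl = bwd-edge′ c1 h (y + h) up (≤h⇒<M h ≤-refl)
          (trans (cong (λ z → colourOf z (par (y + h)) up) (column-last h refl)) (cong byParity (par-odd+even y h py par-h)))
                      (trans (walkB-up y h-1 lt) (⟨⟩-congʳ (suc h) ar))
                      (trans (cong (walkB y) (trans (cong suc (sym (+-identityʳ h))) (sym (+-suc h 0)))) (walkB-down y 0 (≤-trans (s≤s (s≤s z≤n)) 4≤h)))
        where
          ar : y + 1 + hIfOdd (suc h) ≡ y + h + 1
          ar rewrite par-h = trans (+-assoc y 1 h) (trans (cong (y +_) (+-comm 1 h)) (sym (+-assoc y h 1)))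

      step-down : ∀ t' → suc t' < h → Dec (suc (suc t') < h) → Class c1 (walkB y (h + suc t')) (walkB y (suc (h + suc t')))
      step-down t' lt (yes lt') = bwd-edge′ c1 (h ∸ suc t') (y + hIfOdd (suc (suc t'))) half (≤h⇒<M _ (m∸n≤m h (suc t')))
                      (colourOf-column-middle (h ∸ suc t') (m+n≤o⇒m≤o∸n 2 lt') (∸-monoʳ-< (s≤s z≤n) (<⇒≤ lt)) _ half)
                      (trans (walkB-down y t' lt) (trans (cong (λ z → ⟨ z , y + hIfOdd (suc t') ⟩) (+-∸-assoc 1 (<⇒≤ lt)))
                             (sym (trans (⟨⟩-hIfOdd-suc (suc (h ∸ suc t')) y (suc (suc t'))) (⟨⟩-congʳ (suc (h ∸ suc t')) (cong (y +_) (hIfOdd-ss (suc t'))))))))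
                      (trans (cong (walkB y) (sym (+-suc h (suc t')))) (walkB-down y (suc t') lt'))
      step-down t' lt (no nlt) with suc-injective (suc-injective (≤-antisym lt (≮⇒≥ nlt)))
      ... | refl = bwd-edge′ c1 1 y half (≤h⇒<M 1 (≤-trans (s≤s z≤n) 4≤h)) (cong byParity py)
                      (trans (walkB-down y (q-2 + q) lt) (cong₂ ⟨_,_⟩ (m+n∸n≡m 2 (q-2 + q)) (cong (λ z → y + (if z then h else 0)) par-h-1)))
                      (trans (cong (walkB y) (cong suc (+-comm h h-1))) (walkB-N y))

      step : ∀ j → j < N → Class c1 (walkB y j) (walkB y (suc j))
      step j lt with b-view j lt
      ... | b-zero refl = fwd-edge′ c1 1 y up (≤h⇒<M 1 (≤-trans (s≤s z≤n) 4≤h)) (cong byParity py) refl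
                        (trans (walkB-up y 0 (≤-trans (s≤s z≤n) 4≤h)) (⟨⟩-congʳ 2 (+-identityʳ (y + 1))))
      ... | b-up j' jh refl = step-up j' jh (suc j' <? h)
      ... | b-down t' th refl = step-down t' th (suc (suc t') <? h)

  data ColumnView (X : ℕ) : Set where
    at-0 : X ≡ 0 → ColumnView X
    at-1 : X ≡ 1 → ColumnView X
    at-middle : ∀ X' → X ≡ suc X' → 1 ≤ X' → X' < h → ColumnView X
    at-h+1 : X ≡ suc h → ColumnView X
    beyond-h+1 : ∀ X' → X ≡ suc X' → suc h ≤ X' → ColumnView X

  column-view : ∀ X → ColumnView X
  column-view zero = at-0 refl
  column-view (suc zero) = at-1 refl
  column-view (suc (suc X)) with <-cmp (suc (suc X)) (suc h)
  ... | tri< lt _ _ = at-middle (suc X) refl (s≤s z≤n) (≤-pred lt)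
  ... | tri≈ _ eq _ = at-h+1 eq
  ... | tri> _ _ gt' = beyond-h+1 (suc X) refl (≤-pred gt')

  []ₘ-≡ : ∀ (a : Fin M) X → toℕ a ≡ X → [ X ]ₘ ≡ a
  []ₘ-≡ a X e = subst (λ z → [ z ]ₘ ≡ a) e (ZM.[]-toℕ a)

  par-+N-1 : ∀ B → par (B + N-1) ≡ not (par B)
  par-+N-1 B rewrite par-+ B N-1 | par-N-1 with par B
  ... | true = refl
  ... | false = refl

  zigzag-cycle-coloured : ∀ i x y0 v → x < M → column x ≡ wrap → byParity (par y0) ≡ i → ∀ st → st < N → zigzag x y0 st ≡ v → CycleThrough (Class i) N v
  zigzag-cycle-coloured i x y0 v x<M gx ci st st< hit = subst (λ c' → CycleThrough (Class c') N v) ci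
      (zigzag-cycle x y0 v x<M gx st st< hit)

  0<N : 0 < N
  0<N = s≤s z≤n
  1<N : 1 < N
  1<N = s≤s (s≤s z≤n)

  rcase' : ∀ r₀ → r₀ ≡ 0 ⊎ h < h + (r₀ + r₀)
  rcase' zero = inj₁ refl
  rcase' (suc r') = inj₂ (m<m+n h (s≤s z≤n))

  r≡0⊎h<M-1 : r ≡ 0 ⊎ h < M-1
  r≡0⊎h<M-1 = rcase' r

  [h+1]ₘ≡[0]ₘ : r ≡ 0 → [ suc h ]ₘ ≡ [ 0 ]ₘ
  [h+1]ₘ≡[0]ₘ r0 = trans (cong [_]ₘ (cong suc (trans (sym (+-identityʳ h)) (cong (λ z → h + (z + z)) (sym r0))))) (ZM.[+K] 0)

  walkA-h : ∀ y → walkA y h ≡ ⟨ suc h , y + N-1 ⟩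
  walkA-h y = trans (cong (walkA y) (sym (+-identityʳ h))) (walkA-down y 0 (≤-trans (s≤s z≤n) 4≤h))

  walkB-h : ∀ y → walkB y h ≡ ⟨ suc h , y + 1 + h ⟩
  walkB-h y = trans (walkB-up y h-1 ≤-refl)
      (⟨⟩-congʳ (suc h) (cong (λ z → y + 1 + (if z then h else 0)) (trans (cong not par-h) refl)))

  [b+N+N]ₙ≡b : ∀ (b : Fin N) → [ toℕ b + N + N ]ₙ ≡ b
  [b+N+N]ₙ≡b b = trans (ZN.[+K] (toℕ b + N)) (trans (ZN.[+K] (toℕ b)) (ZN.[]-toℕ b))

  [b+N]ₙ≡b : ∀ (b : Fin N) → [ toℕ b + N ]ₙ ≡ b
  [b+N]ₙ≡b b = trans (ZN.[+K] (toℕ b)) (ZN.[]-toℕ b)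

  [b+0]ₙ≡b : ∀ (b : Fin N) → [ toℕ b + 0 ]ₙ ≡ b
  [b+0]ₙ≡b b = trans (cong [_]ₙ (+-identityʳ (toℕ b))) (ZN.[]-toℕ b)

  [b+N-1+o+1+o]ₙ≡b : ∀ (b : Fin N) k → [ toℕ b + N-1 + hIfOdd k + 1 + hIfOdd k ]ₙ ≡ b
  [b+N-1+o+1+o]ₙ≡b b k with par k
  ... | true = trans
      (cong [_]ₙ (solve 3 (λ B n h' → B :+ n :+ h' :+ con 1 :+ h' := B :+ (con 1 :+ n) :+ (h' :+ h')) refl (toℕ b) N-1 h))
      ([b+N+N]ₙ≡b b)
  ... | false = trans (cong [_]ₙ (solve 2 (λ B n → B :+ n :+ con 0 :+ con 1 :+ con 0 := B :+ (con 1 :+ n)) refl (toℕ b) N-1))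
      ([b+N]ₙ≡b b)

  [b+o+o]ₙ≡b : ∀ (b : Fin N) k → [ toℕ b + hIfOdd k + hIfOdd k ]ₙ ≡ b
  [b+o+o]ₙ≡b b k with par k
  ... | true = trans (cong [_]ₙ (+-assoc (toℕ b) h h)) ([b+N]ₙ≡b b)
  ... | false = trans (cong [_]ₙ (+-identityʳ (toℕ b + 0))) ([b+0]ₙ≡b b)

  [b+N-1+h+1+h]ₙ≡b : ∀ (b : Fin N) → [ toℕ b + N-1 + h + 1 + h ]ₙ ≡ b
  [b+N-1+h+1+h]ₙ≡b b = trans
      (cong [_]ₙ (solve 3 (λ B n h' → B :+ n :+ h' :+ con 1 :+ h' := B :+ (con 1 :+ n) :+ (h' :+ h')) refl (toℕ b) N-1 h))
      ([b+N+N]ₙ≡b b)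

  [b+N-1+1]ₙ≡b : ∀ (b : Fin N) → [ toℕ b + N-1 + 1 ]ₙ ≡ b
  [b+N-1+1]ₙ≡b b = trans (cong [_]ₙ (trans (+-assoc (toℕ b) N-1 1) (cong (toℕ b +_) (+-comm N-1 1)))) ([b+N]ₙ≡b b)

  [b+1+N-1]ₙ≡b : ∀ (b : Fin N) → [ toℕ b + 1 + N-1 ]ₙ ≡ b
  [b+1+N-1]ₙ≡b b = trans (cong [_]ₙ (+-assoc (toℕ b) 1 N-1)) ([b+N]ₙ≡b b)

  toℕ≡⇒<M : ∀ (a : Fin M) X → toℕ a ≡ X → X < M
  toℕ≡⇒<M a X e = subst (_< M) e (toℕ<n a)

  [M]ₘ≡ : ∀ (a : Fin M) → toℕ a ≡ 0 → [ M ]ₘ ≡ a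
  [M]ₘ≡ a e = trans (ZM.[+K] 0) ([]ₘ-≡ a 0 e)

  par-odd+1 : ∀ B → par B ≡ true → par (B + 1) ≡ false
  par-odd+1 B pb = par-odd+odd B 1 pb refl

  byParity-+N-1 : ∀ B p → par B ≡ p → byParity (par (B + N-1)) ≡ byParity (not p)
  byParity-+N-1 B p pb = cong byParity (trans (par-+N-1 B) (cong not pb))

  cycleA-ascending : ∀ (a : Fin M) (b : Fin N) X' → toℕ a ≡ suc X' → X' < h → par (toℕ b) ≡ par X' → CycleThrough (Class c0) N (a , b)
  cycleA-ascending a b X' ea lh pb = cycleA y (a , b) py X' (<-trans lh h<N)
      (trans (walkA-up y X' lh) (cong₂ _,_ ([]ₘ-≡ a (suc X') ea) e2))
    where
      y = toℕ b + (N ∸ X')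
      X'≤N = <⇒≤ (<-trans lh h<N)
      py : par y ≡ false
      py = trans (par-+ (toℕ b) (N ∸ X')) (trans (cong₂ _xor_ pb (par-∸-even X' N X'≤N par-N)) (xor-same (par X')))
      e2 : [ y + X' ]ₙ ≡ b
      e2 = trans (cong [_]ₙ (trans (+-assoc (toℕ b) (N ∸ X') X') (cong (toℕ b +_) (m∸n+n≡m X'≤N)))) ([b+N]ₙ≡b b)

  cycleA-descending : ∀ (a : Fin M) (b : Fin N) X' → toℕ a ≡ suc X' → 1 ≤ X' → X' < h → par (toℕ b) ≡ not (par X') → CycleThrough (Class c0) N (a , b)
  cycleA-descending a b X' ea l1 lh pb = cycleA y (a , b) py (h + t) (+-monoʳ-< h tlt)
      (trans (walkA-down y t tlt) (cong₂ _,_ ([]ₘ-≡ a (suc h ∸ t) e1) e2))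
    where
      t = h ∸ X'
      tlt : t < h
      tlt = ∸-monoʳ-< l1 (<⇒≤ lh)
      t≤N' : t ≤ N-1
      t≤N' = ≤-trans (<⇒≤ tlt) (<⇒≤ h<N-1)
      y = toℕ b + suc t
      pt : par t ≡ par X'
      pt = par-∸-even X' h (<⇒≤ lh) par-h
      py : par y ≡ false
      py = trans (par-+ (toℕ b) (suc t)) (trans (cong₂ _xor_ pb (cong not pt)) (xor-same (not (par X'))))
      e1 : toℕ a ≡ suc h ∸ t
      e1 = trans ea (sym (trans (+-∸-assoc 1 (m∸n≤m h X')) (cong suc (m∸[m∸n]≡n (<⇒≤ lh)))))
      e2 : [ y + (N-1 ∸ t) ]ₙ ≡ b
      e2 = trans (cong [_]ₙ (trans (+-assoc (toℕ b) (suc t) (N-1 ∸ t)) (cong (λ z → toℕ b + suc z) (m+[n∸m]≡n t≤N'))))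
          ([b+N]ₙ≡b b)

  cycleA-middle : ∀ (a : Fin M) (b : Fin N) X' → toℕ a ≡ suc X' → 1 ≤ X' → X' < h → ∀ p → par (toℕ b) ≡ p → ∀ pX → par X' ≡ pX → CycleThrough (Class c0) N (a , b)
  cycleA-middle a b X' ea l1 lh true pb true pX = cycleA-ascending a b X' ea lh (trans pb (sym pX))
  cycleA-middle a b X' ea l1 lh false pb false pX = cycleA-ascending a b X' ea lh (trans pb (sym pX))
  cycleA-middle a b X' ea l1 lh true pb false pX = cycleA-descending a b X' ea l1 lh (trans pb (cong not (sym pX)))
  cycleA-middle a b X' ea l1 lh false pb true pX = cycleA-descending a b X' ea l1 lh (trans pb (cong not (sym pX)))

  cycle₀-at : ∀ (a : Fin M) (b : Fin N) X → toℕ a ≡ X → ColumnView X → ∀ p → par (toℕ b) ≡ p → CycleThrough (Class c0) N (a , b)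
  cycle₀-at a b X ea (at-0 refl) false pb = zigzag-cycle-coloured c0 0 B (a , b) (s≤s z≤n) refl (cong byParity pb) 0 0<N
      (cong₂ _,_ ([]ₘ-≡ a 0 ea) ([b+0]ₙ≡b b))
    where B = toℕ b
  cycle₀-at a b X ea (at-0 refl) true pb with r≡0⊎h<M-1
  ... | inj₁ r0 = cycleA (toℕ b + 1) (a , b) (par-odd+1 (toℕ b) pb) h h<N
      (trans (walkA-h (toℕ b + 1)) (cong₂ _,_ (trans ([h+1]ₘ≡[0]ₘ r0) ([]ₘ-≡ a 0 ea)) ([b+1+N-1]ₙ≡b b)))
  ... | inj₂ hM = zigzag-cycle-coloured c0 M-1 (toℕ b + N-1) (a , b) (n<1+n M-1) (column-wrap M-1 hM)
      (byParity-+N-1 (toℕ b) true pb) 1 1<N (cong₂ _,_ ([M]ₘ≡ a ea) ([b+N-1+1]ₙ≡b b))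
  cycle₀-at a b X ea (at-1 refl) false pb = cycleA (toℕ b) (a , b) pb 0 0<N
      (trans (walkA-up (toℕ b) 0 (≤-trans (s≤s z≤n) 4≤h)) (cong₂ _,_ ([]ₘ-≡ a 1 ea) ([b+0]ₙ≡b b)))
  cycle₀-at a b X ea (at-1 refl) true pb = zigzag-cycle-coloured c0 0 (toℕ b + N-1) (a , b) (s≤s z≤n) refl
      (byParity-+N-1 (toℕ b) true pb) 1 1<N (cong₂ _,_ ([]ₘ-≡ a 1 ea) ([b+N-1+1]ₙ≡b b))
  cycle₀-at a b X ea (at-middle X' refl l1 lh) p pb = cycleA-middle a b X' ea l1 lh p pb (par X') refl
  cycle₀-at a b X ea (at-h+1 refl) false pb = zigzag-cycle-coloured c0 (suc h) (toℕ b) (a , b) (toℕ≡⇒<M a (suc h) ea)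
      (column-wrap (suc h) (n<1+n h)) (cong byParity pb) 0 0<N (cong₂ _,_ ([]ₘ-≡ a (suc h) ea) ([b+0]ₙ≡b b))
  cycle₀-at a b X ea (at-h+1 refl) true pb = cycleA (toℕ b + 1) (a , b) (par-odd+1 (toℕ b) pb) h h<N
      (trans (walkA-h (toℕ b + 1)) (cong₂ _,_ ([]ₘ-≡ a (suc h) ea) ([b+1+N-1]ₙ≡b b)))
  cycle₀-at a b X ea (beyond-h+1 X' refl hX) false pb = zigzag-cycle-coloured c0 (suc X') (toℕ b) (a , b) (toℕ≡⇒<M a (suc X') ea)
      (column-wrap (suc X') (s≤s (≤-trans (n≤1+n h) hX))) (cong byParity pb) 0 0<N (cong₂ _,_ ([]ₘ-≡ a (suc X') ea) ([b+0]ₙ≡b b))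
  cycle₀-at a b X ea (beyond-h+1 X' refl hX) true pb = zigzag-cycle-coloured c0 X' (toℕ b + N-1) (a , b)
      (<-trans (n<1+n X') (toℕ≡⇒<M a (suc X') ea)) (column-wrap X' hX) (byParity-+N-1 (toℕ b) true pb) 1 1<N
      (cong₂ _,_ ([]ₘ-≡ a (suc X') ea) ([b+N-1+1]ₙ≡b b))

  cycle₀ : ∀ v → CycleThrough (Class c0) N v
  cycle₀ (a , b) = cycle₀-at a b (toℕ a) refl (column-view (toℕ a)) (par (toℕ b)) refl

  cycleB-ascending : ∀ (a : Fin M) (b : Fin N) j' → toℕ a ≡ suc (suc j') → j' < h → par (toℕ b) ≡ false → CycleThrough (Class c1) N (a , b)
  cycleB-ascending a b j' ea lh pb = cycleB y (a , b) py (suc j') (s≤s (≤-trans lh (<⇒≤ h<N-1)))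
      (trans (walkB-up y j' lh) (cong₂ _,_ ([]ₘ-≡ a _ ea) ([b+N-1+o+1+o]ₙ≡b b (suc (suc j')))))
    where
      y = toℕ b + N-1 + hIfOdd (suc (suc j'))
      py : par y ≡ true
      py = trans (par-+ (toℕ b + N-1) (hIfOdd (suc (suc j'))))
          (trans (cong₂ _xor_ (trans (par-+N-1 (toℕ b)) (cong not pb)) (par-hIfOdd (suc (suc j')))) refl)

  cycleB-descending : ∀ (a : Fin M) (b : Fin N) X' → toℕ a ≡ suc X' → 1 ≤ X' → X' < h → par (toℕ b) ≡ true → CycleThrough (Class c1) N (a , b)
  cycleB-descending a b X' ea l1 lh pb = cycleB y (a , b) py (h + suc t') (+-monoʳ-< h tl)
      (trans (walkB-down y t' tl) (cong₂ _,_ ([]ₘ-≡ a (h ∸ t') e1) ([b+o+o]ₙ≡b b (suc t'))))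
    where
      t' = h ∸ suc X'
      tl : suc t' < h
      tl = s≤s (∸-monoʳ-< l1 (≤-pred lh))
      y = toℕ b + hIfOdd (suc t')
      py : par y ≡ true
      py = trans (par-+ (toℕ b) (hIfOdd (suc t'))) (trans (cong₂ _xor_ pb (par-hIfOdd (suc t'))) refl)
      e1 : toℕ a ≡ h ∸ t'
      e1 = trans ea (sym (m∸[m∸n]≡n lh))

  cycle₁-at : ∀ (a : Fin M) (b : Fin N) X → toℕ a ≡ X → ColumnView X → ∀ p → par (toℕ b) ≡ p → CycleThrough (Class c1) N (a , b)
  cycle₁-at a b X ea (at-0 refl) true pb = zigzag-cycle-coloured c1 0 (toℕ b) (a , b) (s≤s z≤n) refl (cong byParity pb) 0 0<N
      (cong₂ _,_ ([]ₘ-≡ a 0 ea) ([b+0]ₙ≡b b))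
  cycle₁-at a b X ea (at-0 refl) false pb with r≡0⊎h<M-1
  ... | inj₁ r0 = cycleB (toℕ b + N-1 + h) (a , b) pyH h h<N
      (trans (walkB-h (toℕ b + N-1 + h)) (cong₂ _,_ (trans ([h+1]ₘ≡[0]ₘ r0) ([]ₘ-≡ a 0 ea)) ([b+N-1+h+1+h]ₙ≡b b)))
    where
      pyH : par (toℕ b + N-1 + h) ≡ true
      pyH = trans (par-+ (toℕ b + N-1) h) (trans (cong₂ _xor_ (trans (par-+N-1 (toℕ b)) (cong not pb)) par-h) refl)
  ... | inj₂ hM = zigzag-cycle-coloured c1 M-1 (toℕ b + N-1) (a , b) (n<1+n M-1) (column-wrap M-1 hM)
      (byParity-+N-1 (toℕ b) false pb) 1 1<N (cong₂ _,_ ([M]ₘ≡ a ea) ([b+N-1+1]ₙ≡b b))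
  cycle₁-at a b X ea (at-1 refl) true pb = cycleB (toℕ b) (a , b) pb 0 0<N (cong₂ _,_ ([]ₘ-≡ a 1 ea) (ZN.[]-toℕ b))
  cycle₁-at a b X ea (at-1 refl) false pb = zigzag-cycle-coloured c1 0 (toℕ b + N-1) (a , b) (s≤s z≤n) refl
      (byParity-+N-1 (toℕ b) false pb) 1 1<N (cong₂ _,_ ([]ₘ-≡ a 1 ea) ([b+N-1+1]ₙ≡b b))
  cycle₁-at a b X ea (at-middle (suc j') refl (s≤s z≤n) lh) false pb = cycleB-ascending a b j' ea (<-trans (n<1+n j') lh) pb
  cycle₁-at a b X ea (at-middle X' refl l1 lh) true pb = cycleB-descending a b X' ea l1 lh pb
  cycle₁-at a b X ea (at-h+1 refl) true pb = zigzag-cycle-coloured c1 (suc h) (toℕ b) (a , b) (toℕ≡⇒<M a (suc h) ea)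
      (column-wrap (suc h) (n<1+n h)) (cong byParity pb) 0 0<N (cong₂ _,_ ([]ₘ-≡ a (suc h) ea) ([b+0]ₙ≡b b))
  cycle₁-at a b X ea (at-h+1 refl) false pb = cycleB (toℕ b + N-1 + h) (a , b) pyH h h<N
      (trans (walkB-h (toℕ b + N-1 + h)) (cong₂ _,_ ([]ₘ-≡ a (suc h) ea) ([b+N-1+h+1+h]ₙ≡b b)))
    where
      pyH : par (toℕ b + N-1 + h) ≡ true
      pyH = trans (par-+ (toℕ b + N-1) h) (trans (cong₂ _xor_ (trans (par-+N-1 (toℕ b)) (cong not pb)) par-h) refl)
  cycle₁-at a b X ea (beyond-h+1 X' refl hX) true pb = zigzag-cycle-coloured c1 (suc X') (toℕ b) (a , b) (toℕ≡⇒<M a (suc X') ea)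
      (column-wrap (suc X') (s≤s (≤-trans (n≤1+n h) hX))) (cong byParity pb) 0 0<N (cong₂ _,_ ([]ₘ-≡ a (suc X') ea) ([b+0]ₙ≡b b))
  cycle₁-at a b X ea (beyond-h+1 X' refl hX) false pb = zigzag-cycle-coloured c1 X' (toℕ b + N-1) (a , b)
      (<-trans (n<1+n X') (toℕ≡⇒<M a (suc X') ea)) (column-wrap X' hX) (byParity-+N-1 (toℕ b) false pb) 1 1<N
      (cong₂ _,_ ([]ₘ-≡ a (suc X') ea) ([b+N-1+1]ₙ≡b b))

  cycle₁ : ∀ v → CycleThrough (Class c1) N v
  cycle₁ (a , b) = cycle₁-at a b (toℕ a) refl (column-view (toℕ a)) (par (toℕ b)) refl

  [b+[N∸o%N]+o]ₙ≡b : ∀ (b : Fin N) o → [ toℕ b + (N ∸ o % N) + o ]ₙ ≡ b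
  [b+[N∸o%N]+o]ₙ≡b b o = toℕ-injective (begin
      toℕ [ B + (N ∸ o % N) + o ]ₙ ≡⟨ ZN.toℕ-[] (B + (N ∸ o % N) + o) ⟩
      (B + (N ∸ o % N) + o) % N ≡⟨ sym (ZN.[x+y%K]%K≡[x+y]%K (B + (N ∸ o % N)) o) ⟩
      (B + (N ∸ o % N) + o % N) % N ≡⟨ cong (_% N) (trans (+-assoc B (N ∸ o % N) (o % N)) (cong (B +_) (m∸n+n≡m (<⇒≤ (m%n<n o N))))) ⟩
      (B + N) % N ≡⟨ [m+n]%n≡m%n B N ⟩
      B % N ≡⟨ ZN.toℕ%K b ⟩
      B ∎)
    where B = toℕ b

  cycle₂ : ∀ v → CycleThrough (Class c2) M v
  cycle₂ (a , b) = long-cycle y (a , b) (toℕ a) (toℕ<n a) (cong₂ _,_ (ZM.[]-toℕ a) ([b+[N∸o%N]+o]ₙ≡b b (longOffset (toℕ a))))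
    where y = toℕ b + (N ∸ longOffset (toℕ a) % N)

  decomposition : Decomposition M N h
  decomposition = colour , colour-sym , class-factor
    where
      2≤N-1 : 2 ≤ N-1
      2≤N-1 = ≤-trans (s≤s (s≤s (z≤n {2}))) (≤-trans 4≤h (<⇒≤ h<N-1))
      2≤M-1 : 2 ≤ M-1
      2≤M-1 = ≤-trans (s≤s (s≤s (z≤n {2}))) (≤-trans 4≤h h≤M-1)
      class-factor : ∀ (i : Fin 3) → IsCkFactor (lookup (N ∷ N ∷ M ∷ []) i) (λ a b → G a b × colour a b ≡ i)
      class-factor fz = CycleFactor.cycles⇒factor (Class c0) (Class-sym c0) (Class-degree c0) N-1 2≤N-1 cycle₀
      class-factor (fs fz) = CycleFactor.cycles⇒factor (Class c1) (Class-sym c1) (Class-degree c1) N-1 2≤N-1 cycle₁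
      class-factor (fs (fs fz)) = CycleFactor.cycles⇒factor (Class c2) (Class-sym c2) (Class-degree c2) M-1 2≤M-1 cycle₂

Decomposition-cong : ∀ {M N h M′ N′ h′} → M ≡ M′ → N ≡ N′ → h ≡ h′ → Decomposition M N h → Decomposition M′ N′ h′
Decomposition-cong refl refl refl D = D

2^n+2^n≡2^[1+n] : ∀ n → 2 ^ n + 2 ^ n ≡ 2 ^ suc n
2^n+2^n≡2^[1+n] n = cong (2 ^ n +_) (sym (+-identityʳ (2 ^ n)))

odd⇒≡1+k+k : ∀ m → ¬ (2 ∣ m) → ∃ λ k → m ≡ suc (k + k)
odd⇒≡1+k+k zero ¬2∣m = ⊥-elim (¬2∣m (2 ∣0))
odd⇒≡1+k+k (suc zero) _ = 0 , refl
odd⇒≡1+k+k (suc (suc m)) ¬2∣m with odd⇒≡1+k+k m (λ 2∣m → ¬2∣m (∣m∣n⇒∣m+n (∣-refl {2}) 2∣m))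
... | k , refl = suc k , cong (suc ∘ suc) (sym (+-suc k k))

odd≥1+q+q⇒≡1+q+q+r+r : ∀ m q → ¬ (2 ∣ m) → suc (q + q) ≤ m → ∃ λ r → m ≡ suc ((q + q) + (r + r))
odd≥1+q+q⇒≡1+q+q+r+r m q ¬2∣m 1+q+q≤m with odd⇒≡1+k+k m ¬2∣m
... | k , refl = k ∸ q , cong suc (begin
    k + k                          ≡⟨ cong₂ _+_ k≡q+r k≡q+r ⟩
    (q + (k ∸ q)) + (q + (k ∸ q))  ≡⟨ solve 2 (λ q r → (q :+ r) :+ (q :+ r) := (q :+ q) :+ (r :+ r)) refl q (k ∸ q) ⟩
    (q + q) + ((k ∸ q) + (k ∸ q))  ∎)
  where
    open ≡-Reasoning
    q≤k : q ≤ k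
    q≤k = ≮⇒≥ λ k<q → <⇒≱ (+-mono-< k<q k<q) (≤-pred 1+q+q≤m)
    k≡q+r : k ≡ q + (k ∸ q)
    k≡q+r = sym (m+[n∸m]≡n q≤k)

lemma2p7 : (l m : ℕ) → l ≥ 3 → m ≥ 2 ^ (l ∸ 1) + 1 → ¬ (2 ∣ m) →
    DecomposesInto (Cay m (2 ^ l) (Sₗ l m)) (2 ^ l ∷ 2 ^ l ∷ m ∷ [])
lemma2p7 (suc (suc (suc l))) m (s≤s (s≤s (s≤s _))) m≥h+1 ¬2∣m =
  Decomposition-cong (sym m≡M) N≡2^l h≡2^[l-1] (Cycles.decomposition (q ∸ 2) r)
  where
    q = 2 ^ suc l
    q≡2^[l-2] : 2 + (q ∸ 2) ≡ q
    q≡2^[l-2] = m+[n∸m]≡n (*-monoʳ-≤ 2 (m^n>0 2 l))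
    h≡2^[l-1] : (2 + (q ∸ 2)) + (2 + (q ∸ 2)) ≡ 2 ^ suc (suc l)
    h≡2^[l-1] = trans (cong₂ _+_ q≡2^[l-2] q≡2^[l-2]) (2^n+2^n≡2^[1+n] (suc l))
    N≡2^l : ((2 + (q ∸ 2)) + (2 + (q ∸ 2))) + ((2 + (q ∸ 2)) + (2 + (q ∸ 2))) ≡ 2 ^ suc (suc (suc l))
    N≡2^l = trans (cong₂ _+_ h≡2^[l-1] h≡2^[l-1]) (2^n+2^n≡2^[1+n] (suc (suc l)))
    m-odd-form : ∃ λ r → m ≡ suc ((q + q) + (r + r))
    m-odd-form = odd≥1+q+q⇒≡1+q+q+r+r m q ¬2∣m
      (subst (_≤ m) (trans (+-comm _ 1) (cong suc (sym (2^n+2^n≡2^[1+n] (suc l))))) m≥h+1)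
    r = proj₁ m-odd-form
    m≡M : m ≡ suc (((2 + (q ∸ 2)) + (2 + (q ∸ 2))) + (r + r))
    m≡M = trans (proj₂ m-odd-form) (cong (λ z → suc ((z + z) + (r + r))) (sym q≡2^[l-2]))
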